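{- Let $\mathcal{M}$ be a simple oriented matroid (no loops, no parallel or antiparallel elements) on the ground set $E_t=\{1,\ldots,t\}$ which is not acyclic, and let $\mathcal{T}$ be its set of topes. Let $k$ be an integer with $3\leq k\leq|\mathcal{T}|-3$, and let $\ell\in\{k,\,|\mathcal{T}|-k\}$. Then \[ \#\mathbf{K}^{\ast}_k(\mathcal{M})=\#\mathbf{K}^{\ast}_{|\mathcal{T}|-k}(\mathcal{M})= \sum_{\mathcal{G}}\mu_{\boldsymbol{\mathcal{C}}}(\hat{0},\mathcal{G})\cdot\sum_{G\in\boldsymbol{\mathcal{E}}(\mathcal{G}):\ 0<|G|\leq \ell}\mu_{\boldsymbol{\mathcal{E}}}(\hat{0},G)\cdot\binom{|\mathcal{T}|-|G|}{\ell-|G|}\ , \] where the outer sum runs over all families $\mathcal{G}$ of the form $\bigcup_{e\in E}\binom{\mathcal{T}^+_e}{\lceil(\ell+1)/2\rceil}$ with $E\subseteq E_t$, $|E|>0$, and $\mu_{\boldsymbol{\mathcal{C}}}(\cdot,\cdot)$ is the Möbius function of the poset $\boldsymbol{\mathcal{C}}:=\{\hat 0\}\,\dot\cup\,\bigl\{\bigcup_{e\in E}\binom{\mathcal{T}^+_e}{\lceil(\ell+1)/2\rceil}: E\subseteq E_t,\ |E|>0\bigr\}$ ordered by inclusion (with $\hat 0$ a new least element).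
   Context: Topes are the maximal covectors of $\mathcal{M}$, viewed as sign vectors $T\in\{+,-\}^{E_t}$; $\mathcal{T}=-\mathcal{T}$. For $e\in E_t$, $\mathcal{T}^+_e:=\{T\in\mathcal{T}: T(e)=+\}$. For a set $S$ and integer $j$, $\binom{S}{j}$ is the family of all $j$-element subsets of $S$, and $\bigcup_{e\in E}\binom{\mathcal{T}^+_e}{j}$ is the union of these families. For $3\leq k\leq|\mathcal{T}|-3$, $\mathbf{K}^{\ast}_k(\mathcal{M}):=\{\mathcal{K}^{\ast}\subset\mathcal{T}: |\mathcal{K}^{\ast}|=k,\ |\mathcal{K}^{\ast}\cap\mathcal{T}^+_e|>k/2\ \ \forall e\in E_t\}$ (tope committees of cardinality $k$). For a family $\mathcal{G}$ of subsets of $\mathcal{T}$, $\boldsymbol{\mathcal{E}}(\mathcal{G})$ is the poset of all unions $\bigcup_{F\in\mathcal{F}}F$ over nonempty subfamilies $\mathcal{F}\subseteq\mathcal{G}$, ordered by inclusion, with a new least element $\hat 0$ adjoined; $\mu_{\boldsymbol{\mathcal{E}}}$ is its Möbius function, and $|G|$ is the cardinality of a set $G\neq\hat0$. -}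

module Defs where

open import Data.Bool using (Bool; true; false; _∧_; _∨_; not; if_then_else_)
open import Data.Nat using (ℕ; zero; suc; _+_; _*_; _∸_; _≤_; _<_; _≡ᵇ_; _<ᵇ_; _≤ᵇ_; ⌈_/2⌉)
open import Data.Nat.Combinatorics using (_C_)
open import Data.Integer as ℤ using (ℤ; +_; -_)
open import Data.Fin using (Fin; zero; suc)
open import Data.Vec as Vec using (Vec; []; _∷_; lookup; tabulate)
open import Data.List as List using (List; []; _∷_; length; filterᵇ; deduplicateᵇ; allFin; concatMap)
open import Data.Bool.ListAction using (all; any)
open import Data.Fin.Subset using (Subset; ∣_∣; _∩_; _∪_; ⊥)
open import Data.Product using (Σ; ∃; _×_; _,_)
open import Data.Sum using (_⊎_)
open import Relation.Binary.PropositionalEquality using (_≡_; _≢_)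
open import Relation.Nullary using (¬_)

data Sign : Set where
  zer pos neg : Sign

opp : Sign → Sign
opp zer = zer
opp pos = neg
opp neg = pos

_·ˢ_ : Sign → Sign → Sign
zer ·ˢ _ = zer
pos ·ˢ s = s
neg ·ˢ s = opp s

_==ˢ_ : Sign → Sign → Bool
zer ==ˢ zer = true
pos ==ˢ pos = true
neg ==ˢ neg = true
_ ==ˢ _ = false

SignVec : ℕ → Set
SignVec t = Vec Sign t

zeroVec : ∀ {t} → SignVec t
zeroVec = Vec.replicate _ zer

negVec : ∀ {t} → SignVec t → SignVec t
negVec = Vec.map opp

compose : ∀ {t} → SignVec t → SignVec t → SignVec t
compose X Y = Vec.zipWith (λ x y → if x ==ˢ zer then y else x) X Y

-- Oriented matroids via covector axioms.  A finite set of sign vectors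
-- is given by its characteristic function L : SignVec t → Bool.

_∈L_ : ∀ {t} → SignVec t → (SignVec t → Bool) → Set
X ∈L L = L X ≡ true

Sep : ∀ {t} → SignVec t → SignVec t → Fin t → Set
Sep X Y e = (lookup X e ≢ zer) × (lookup X e ≡ opp (lookup Y e))

record IsOrientedMatroid {t : ℕ} (L : SignVec t → Bool) : Set where
  field
    V0 : zeroVec ∈L L
    V1 : ∀ X → X ∈L L → negVec X ∈L L
    V2 : ∀ X Y → X ∈L L → Y ∈L L → compose X Y ∈L L
    V3 : ∀ X Y → X ∈L L → Y ∈L L → ∀ e → Sep X Y e →
         ∃ λ Z → Z ∈L L × lookup Z e ≡ zer ×
                 (∀ f → ¬ Sep X Y f → lookup Z f ≡ lookup (compose X Y) f)

Orth : ∀ {t} → SignVec t → SignVec t → Set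
Orth X Y = (∀ e → (lookup X e ·ˢ lookup Y e) ≡ zer)
         ⊎ ((∃ λ e → (lookup X e ·ˢ lookup Y e) ≡ pos)
            × (∃ λ f → (lookup X f ·ˢ lookup Y f) ≡ neg))

IsVector : ∀ {t} → (SignVec t → Bool) → SignVec t → Set
IsVector L V = ∀ X → X ∈L L → Orth X V

NonZero : ∀ {t} → SignVec t → Set
NonZero V = ∃ λ e → lookup V e ≢ zer

SuppSub : ∀ {t} → SignVec t → SignVec t → Set
SuppSub W V = ∀ e → lookup W e ≢ zer → lookup V e ≢ zer

IsCircuit : ∀ {t} → (SignVec t → Bool) → SignVec t → Set
IsCircuit L Cv = IsVector L Cv × NonZero Cv ×
  (∀ W → IsVector L W → NonZero W → SuppSub W Cv → SuppSub Cv W)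

IsAcyclic : ∀ {t} → (SignVec t → Bool) → Set
IsAcyclic L = ¬ (∃ λ Cv → IsCircuit L Cv × (∀ e → lookup Cv e ≢ neg))

IsLoop : ∀ {t} → (SignVec t → Bool) → Fin t → Set
IsLoop L e = ∃ λ Cv → IsCircuit L Cv × (∀ g → (lookup Cv g ≢ zer → g ≡ e) × (g ≡ e → lookup Cv g ≢ zer))

IsParallelOrAntiparallel : ∀ {t} → (SignVec t → Bool) → Fin t → Fin t → Set
IsParallelOrAntiparallel L e f = (e ≢ f) × (∃ λ Cv → IsCircuit L Cv ×
  (∀ g → (lookup Cv g ≢ zer → g ≡ e ⊎ g ≡ f) × (g ≡ e ⊎ g ≡ f → lookup Cv g ≢ zer)))

IsSimple : ∀ {t} → (SignVec t → Bool) → Set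
IsSimple L = (∀ e → ¬ IsLoop L e) × (∀ e f → ¬ IsParallelOrAntiparallel L e f)

allSignVecs : (t : ℕ) → List (SignVec t)
allSignVecs zero    = [] ∷ []
allSignVecs (suc t) = concatMap (λ s → List.map (s ∷_) (allSignVecs t)) (zer ∷ pos ∷ neg ∷ [])

allSubsets : (n : ℕ) → List (Subset n)
allSubsets zero    = [] ∷ []
allSubsets (suc n) = concatMap (λ b → List.map (b ∷_) (allSubsets n)) (false ∷ true ∷ [])

vecEqᵇ : ∀ {A : Set} {n} → (A → A → Bool) → Vec A n → Vec A n → Bool
vecEqᵇ eq [] [] = true
vecEqᵇ eq (x ∷ xs) (y ∷ ys) = eq x y ∧ vecEqᵇ eq xs ys

boolEq : Bool → Bool → Bool
boolEq true true = true
boolEq false false = true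
boolEq _ _ = false

conformalᵇ : ∀ {t} → SignVec t → SignVec t → Bool
conformalᵇ {t} X Y = all (λ e → (lookup X e ==ˢ zer) ∨ (lookup X e ==ˢ lookup Y e)) (allFin t)

isTopeᵇ : ∀ {t} → (SignVec t → Bool) → SignVec t → Bool
isTopeᵇ {t} L T = L T ∧ all (λ Y → not (L Y ∧ conformalᵇ T Y) ∨ vecEqᵇ _==ˢ_ Y T) (allSignVecs t)

topes : ∀ {t} → (SignVec t → Bool) → List (SignVec t)
topes {t} L = filterᵇ (isTopeᵇ L) (allSignVecs t)

nTopes : ∀ {t} → (SignVec t → Bool) → ℕ
nTopes L = length (topes L)

-- subsets of 𝒯 are subsets of the index set Fin |𝒯|
TopeSet : ∀ {t} → (SignVec t → Bool) → Set
TopeSet L = Subset (nTopes L)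

Tplus : ∀ {t} (L : SignVec t → Bool) → Fin t → TopeSet L
Tplus L e = tabulate (λ i → lookup (List.lookup (topes L) i) e ==ˢ pos)

subsetᵇ : ∀ {n} → Subset n → Subset n → Bool
subsetᵇ A B = vecEqᵇ boolEq (A ∩ B) A

-- Tope committees:  |K| = k and  |K ∩ 𝒯⁺_e| > k/2  (i.e. 2|K∩𝒯⁺_e| > k)

isCommitteeᵇ : ∀ {t} (L : SignVec t → Bool) → ℕ → TopeSet L → Bool
isCommitteeᵇ {t} L k K =
  (∣ K ∣ ≡ᵇ k) ∧ all (λ e → k <ᵇ (2 * ∣ K ∩ Tplus L e ∣)) (allFin t)

numCommittees : ∀ {t} → (SignVec t → Bool) → ℕ → ℕ
numCommittees L k = length (filterᵇ (isCommitteeᵇ L k) (allSubsets (nTopes L)))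

-- Möbius function μ(0̂, x) of a finite poset {0̂} ∪ xs (0̂ a new least
-- element), where xs is duplicate-free and lt is the strict order:
--   μ(0̂,0̂) = 1,   μ(0̂,x) = - Σ_{0̂ ≤ y < x} μ(0̂,y).
-- The recursion is run with fuel; fuel = length xs suffices since every
-- strict chain in xs has at most length xs elements.

sumℤ : List ℤ → ℤ
sumℤ = List.foldr ℤ._+_ (+ 0)

mobiusFuel : ∀ {A : Set} → (A → A → Bool) → List A → ℕ → A → ℤ
mobiusFuel lt xs zero    x = + 0
mobiusFuel lt xs (suc f) x =
  - (+ 1 ℤ.+ sumℤ (List.map (mobiusFuel lt xs f) (filterᵇ (λ y → lt y x) xs)))

mobiusFromBottom : ∀ {A : Set} → (A → A → Bool) → List A → A → ℤ
mobiusFromBottom lt xs x = mobiusFuel lt xs (length xs) x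

-- Families of sets of topes are represented canonically as the list of
-- their members in the order of allSubsets (so ≡ is set equality).

Family : ∀ {t} → (SignVec t → Bool) → Set
Family L = List (TopeSet L)

memberᵇ : ∀ {n} → Subset n → List (Subset n) → Bool
memberᵇ G 𝒢 = any (vecEqᵇ boolEq G) 𝒢

familyOf : ∀ {t} (L : SignVec t → Bool) → ℕ → Subset t → Family L
familyOf {t} L m E = filterᵇ
  (λ G → (∣ G ∣ ≡ᵇ m) ∧ any (λ e → lookup E e ∧ subsetᵇ G (Tplus L e)) (allFin t))
  (allSubsets (nTopes L))

famEqᵇ : ∀ {n} → List (Subset n) → List (Subset n) → Bool
famEqᵇ [] [] = true
famEqᵇ (x ∷ xs) (y ∷ ys) = vecEqᵇ boolEq x y ∧ famEqᵇ xs ys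
famEqᵇ _ _ = false

famStrictSubᵇ : ∀ {n} → List (Subset n) → List (Subset n) → Bool
famStrictSubᵇ 𝒢 ℋ = all (λ G → memberᵇ G ℋ) 𝒢 ∧ not (famEqᵇ 𝒢 ℋ)

-- the elements ≠ 0̂ of the poset 𝓒, for a given ℓ  (m = ⌈(ℓ+1)/2⌉)
posetC : ∀ {t} (L : SignVec t → Bool) → ℕ → List (Family L)
posetC {t} L ℓ = deduplicateᵇ famEqᵇ
  (List.map (familyOf L ⌈ suc ℓ /2⌉) (filterᵇ (λ E → 0 <ᵇ ∣ E ∣) (allSubsets t)))

-- the elements ≠ 0̂ of 𝓔(𝒢): unions of nonempty subfamilies
sublists : ∀ {A : Set} → List A → List (List A)
sublists [] = [] ∷ []
sublists (x ∷ xs) = let r = sublists xs in r List.++ List.map (x ∷_) r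

nonEmptyᵇ : ∀ {A : Set} → List A → Bool
nonEmptyᵇ [] = false
nonEmptyᵇ (_ ∷ _) = true

unionAll : ∀ {n} → List (Subset n) → Subset n
unionAll = List.foldr _∪_ ⊥

posetE : ∀ {n} → List (Subset n) → List (Subset n)
posetE 𝒢 = deduplicateᵇ (vecEqᵇ boolEq)
  (List.map unionAll (filterᵇ nonEmptyᵇ (sublists 𝒢)))

strictSubᵇ : ∀ {n} → Subset n → Subset n → Bool
strictSubᵇ A B = subsetᵇ A B ∧ not (vecEqᵇ boolEq A B)

innerSum : ∀ {t} (L : SignVec t → Bool) → ℕ → Family L → ℤ
innerSum L ℓ 𝒢 = sumℤ (List.map
  (λ G → mobiusFromBottom strictSubᵇ (posetE 𝒢) G ℤ.* + ((nTopes L ∸ ∣ G ∣) C (ℓ ∸ ∣ G ∣)))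
  (filterᵇ (λ G → (0 <ᵇ ∣ G ∣) ∧ (∣ G ∣ ≤ᵇ ℓ)) (posetE 𝒢)))

committeeFormula : ∀ {t} → (SignVec t → Bool) → ℕ → ℤ
committeeFormula L ℓ = sumℤ (List.map
  (λ 𝒢 → mobiusFromBottom famStrictSubᵇ (posetC L ℓ) 𝒢 ℤ.* innerSum L ℓ 𝒢)
  (posetC L ℓ))

-- For a family 𝒢 of nonempty sets of topes, Möbius inversion on the union poset 𝓔(𝒢) gives
-- Σ_{G ∈ 𝓔(𝒢), G ⊆ K} μ(0̂,G) = −[K contains a member of 𝒢]. Since binom(|𝒯|−|G|, ℓ−|G|) counts
-- the ℓ-sets K ⊇ G, the inner sum is −#{K : |K| = ℓ, K contains a member of 𝒢}. With
-- m = ⌈(ℓ+1)/2⌉ and 𝒢_E = ⋃_{e∈E} binom(𝒯⁺_e, m), an ℓ-set K contains a member of 𝒢_E iff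
-- |K ∩ 𝒯⁺_e| > ℓ/2 for some e ∈ E, i.e. unless 𝒢_E ⊆ 𝒢_B for the set B of elements on which K
-- has no majority. Möbius inversion on 𝓒, whose top element is 𝒢_{E_t}, turns the outer sum
-- into [B = ∅], the indicator that K is a committee; none of this uses that the 𝒯⁺_e are tope sets.
-- For the symmetry: no tope of a simple oriented matroid has a zero entry, so T ↦ −T exchanges
-- 𝒯⁺_e with its complement, and K ↦ 𝒯 ∖ (−K) maps the committees of size k bijectively onto
-- those of size |𝒯| − k.

module Submission where

open import Defs
open import Data.Bool using (Bool; true; false; _∧_; _∨_; not; T; if_then_else_)
open import Data.Bool.Properties using (∧-zeroʳ; ∨-zeroʳ; not-involutive; T-≡)
open import Data.Bool.ListAction using (and; all; any)
open import Data.Empty using (⊥-elim) renaming (⊥ to Empty)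
open import Data.Fin using (Fin; zero; suc; _≟_)
open import Data.Fin.Subset using (Subset; ∣_∣; _∩_; _∪_; ∁; ⊥; ⊤; _⊆_)
open import Data.Fin.Subset.Properties
  using ( ⊆-refl; ⊆-trans; ⊆-antisym; drop-∷-⊆; out⊆; in⊆in; p⊆p∪q; q⊆p∪q; x∈p∪q⁻; ∉⊥; p∩q⊆p; p∩q⊆q
        ; x∈p∩q⁺; p⊆q⇒∣p∣≤∣q∣; ∣p∣≤n; ⊥⊆; ∣⊥∣≡0; ∣∁p∣≡n∸∣p∣ )
open import Data.Integer using (ℤ; +_; -_; _+_; _*_)
import Data.Integer.Properties as ℤ
open import Algebra.Properties.CommutativeSemigroup ℤ.*-commutativeSemigroup using (x∙yz≈y∙xz)
open import Algebra.Properties.CommutativeSemigroup ℤ.+-commutativeSemigroup using () renaming (interchange to +-interchange)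
open import Data.List using (List; []; _∷_; map; concatMap; length; filterᵇ; _++_; allFin; deduplicateᵇ)
open import Data.List.Membership.Propositional using (_∈_)
open import Data.List.Relation.Unary.Any as Any using (here; there)
import Data.List.Relation.Unary.Any.Properties as AnyP
open import Data.List.Relation.Unary.All as All using (All; []; _∷_)
open import Data.List.Relation.Unary.All.Properties using (all-filter)
open import Data.List.Relation.Unary.Unique.Propositional using (Unique; []; _∷_)
import Data.List.Relation.Unary.Unique.Propositional.Properties as Unique
import Data.List.Membership.Propositional.Properties as ∈
import Data.List.Membership.Setoid.Properties as ∈ˢ
import Data.List.Properties as List
open import Relation.Nullary.Decidable using (T?; dec-true)
open import Data.Nat.Combinatorics using (_C_; nCk+nC[k+1]≡[n+1]C[k+1])
open import Data.Nat using (ℕ; zero; suc; _≤_; _<_; s≤s; z≤n; _∸_; _≡ᵇ_; _<ᵇ_; _≤ᵇ_; ⌈_/2⌉)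
import Data.Nat as ℕ
import Data.Nat.Properties as ℕ
open import Data.Nat.Solver using (module +-*-Solver)
open import Data.Product using (∃; _×_; _,_; proj₁; proj₂)
open import Data.Sum using (_⊎_; inj₁; inj₂)
open import Data.Vec using (Vec; []; _∷_; lookup; tabulate)
import Data.Vec as Vec
import Data.Vec.Properties as Vec
open import Function using (_∘_; _∘₂_; Equivalence)
open import Relation.Binary.PropositionalEquality
open import Relation.Nullary using (¬_; ¬?; yes; no; does)

𝟙[_] : Bool → ℤ
𝟙[ true ] = + 1
𝟙[ false ] = + 0

𝟙-∧ : ∀ a b → 𝟙[ a ] * 𝟙[ b ] ≡ 𝟙[ a ∧ b ]
𝟙-∧ true b = ℤ.*-identityˡ 𝟙[ b ]
𝟙-∧ false b = refl

*-neg-𝟙-not : ∀ c x → x * - 𝟙[ not c ] ≡ 𝟙[ c ] * x + - (+ 1 * x)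
*-neg-𝟙-not true x = trans (ℤ.*-zeroʳ x) (sym (ℤ.+-inverseʳ (+ 1 * x)))
*-neg-𝟙-not false x = begin
  x * - + 1             ≡⟨ ℤ.neg-distribʳ-* x (+ 1) ⟨
  - (x * + 1)           ≡⟨ cong -_ (ℤ.*-comm x (+ 1)) ⟩
  - (+ 1 * x)           ≡⟨ ℤ.+-identityˡ _ ⟨
  + 0 + - (+ 1 * x)     ≡⟨ cong (_+ - (+ 1 * x)) (ℤ.*-zeroˡ x) ⟨
  + 0 * x + - (+ 1 * x) ∎
  where open ≡-Reasoning

∧-cong-guarded : ∀ {a a′ b b′} → a ≡ a′ → (a′ ≡ true → b ≡ b′) → a ∧ b ≡ a′ ∧ b′
∧-cong-guarded {a′ = true} refl b≡b′ = b≡b′ refl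
∧-cong-guarded {a′ = false} refl _ = refl

≡true-⇔⇒≡ : ∀ {a b} → (a ≡ true → b ≡ true) → (b ≡ true → a ≡ true) → a ≡ b
≡true-⇔⇒≡ {true} {true} _ _ = refl
≡true-⇔⇒≡ {false} {false} _ _ = refl
≡true-⇔⇒≡ {true} {false} to _ = sym (to refl)
≡true-⇔⇒≡ {false} {true} _ from = from refl

∑ : {A : Set} → List A → (A → ℤ) → ℤ
∑ xs f = sumℤ (map f xs)

module _ {A : Set} where

  ∑-++ : ∀ (xs ys : List A) f → ∑ (xs ++ ys) f ≡ ∑ xs f + ∑ ys f
  ∑-++ [] ys f = sym (ℤ.+-identityˡ _)
  ∑-++ (x ∷ xs) ys f rewrite ∑-++ xs ys f = sym (ℤ.+-assoc (f x) _ _)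

  ∑-cong-local : ∀ (xs : List A) {f g} → (∀ x → x ∈ xs → f x ≡ g x) → ∑ xs f ≡ ∑ xs g
  ∑-cong-local [] h = refl
  ∑-cong-local (x ∷ xs) h = cong₂ _+_ (h x (here refl)) (∑-cong-local xs (λ y p → h y (there p)))

  ∑-cong : ∀ (xs : List A) {f g} → (∀ x → f x ≡ g x) → ∑ xs f ≡ ∑ xs g
  ∑-cong xs h = ∑-cong-local xs (λ x _ → h x)

  ∑-zero : ∀ (xs : List A) → ∑ xs (λ _ → + 0) ≡ + 0
  ∑-zero [] = refl
  ∑-zero (x ∷ xs) = trans (ℤ.+-identityˡ _) (∑-zero xs)

  ∑-+ : ∀ (xs : List A) f g → ∑ xs (λ x → f x + g x) ≡ ∑ xs f + ∑ xs g
  ∑-+ [] f g = refl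
  ∑-+ (x ∷ xs) f g rewrite ∑-+ xs f g = +-interchange (f x) (g x) (∑ xs f) (∑ xs g)

  ∑-*ˡ : ∀ (xs : List A) c f → ∑ xs (λ x → c * f x) ≡ c * ∑ xs f
  ∑-*ˡ [] c f = sym (ℤ.*-zeroʳ c)
  ∑-*ˡ (x ∷ xs) c f rewrite ∑-*ˡ xs c f = sym (ℤ.*-distribˡ-+ c (f x) (∑ xs f))

  ∑-neg : ∀ (xs : List A) f → ∑ xs (λ x → - f x) ≡ - ∑ xs f
  ∑-neg [] f = refl
  ∑-neg (x ∷ xs) f rewrite ∑-neg xs f = sym (ℤ.neg-distrib-+ (f x) (∑ xs f))

  ∑-filterᵇ : ∀ (xs : List A) p f → ∑ (filterᵇ p xs) f ≡ ∑ xs (λ x → 𝟙[ p x ] * f x)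
  ∑-filterᵇ [] p f = refl
  ∑-filterᵇ (x ∷ xs) p f with p x
  ... | true = cong₂ _+_ (sym (ℤ.*-identityˡ (f x))) (∑-filterᵇ xs p f)
  ... | false = begin
    ∑ (filterᵇ p xs) f ≡⟨ ∑-filterᵇ xs p f ⟩
    S                  ≡⟨ ℤ.+-identityˡ S ⟨
    + 0 + S            ≡⟨ cong (_+ S) (ℤ.*-zeroˡ (f x)) ⟨
    + 0 * f x + S      ∎
    where
    open ≡-Reasoning
    S = ∑ xs (λ y → 𝟙[ p y ] * f y)

  length-filterᵇ : ∀ (xs : List A) p → + length (filterᵇ p xs) ≡ ∑ xs (λ x → 𝟙[ p x ])
  length-filterᵇ [] p = refl
  length-filterᵇ (x ∷ xs) p with p x
  ... | true = cong (_+_ (+ 1)) (length-filterᵇ xs p)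
  ... | false = trans (length-filterᵇ xs p) (sym (ℤ.+-identityˡ _))

module _ {A B : Set} where

  ∑-map : ∀ (g : A → B) xs f → ∑ (map g xs) f ≡ ∑ xs (λ x → f (g x))
  ∑-map g [] f = refl
  ∑-map g (x ∷ xs) f = cong (_+_ (f (g x))) (∑-map g xs f)

  ∑-comm : ∀ (xs : List A) (ys : List B) (f : A → B → ℤ) →
    ∑ xs (λ x → ∑ ys (λ y → f x y)) ≡ ∑ ys (λ y → ∑ xs (λ x → f x y))
  ∑-comm [] ys f = sym (∑-zero ys)
  ∑-comm (x ∷ xs) ys f = begin
    ∑ ys (f x) + ∑ xs (λ x′ → ∑ ys (f x′))         ≡⟨ cong (_+_ (∑ ys (f x))) (∑-comm xs ys f) ⟩
    ∑ ys (f x) + ∑ ys (λ y → ∑ xs (λ x′ → f x′ y)) ≡⟨ ∑-+ ys (f x) _ ⟨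
    ∑ ys (λ y → f x y + ∑ xs (λ x′ → f x′ y))      ∎
    where open ≡-Reasoning

module _ {A : Set} where

  ∈-filterᵇ⁺ : ∀ (p : A → Bool) {xs x} → x ∈ xs → p x ≡ true → x ∈ filterᵇ p xs
  ∈-filterᵇ⁺ p x∈xs px = ∈.∈-filter⁺ (T? ∘ p) x∈xs (Equivalence.from T-≡ px)

  ∈-filterᵇ⁻ : ∀ (p : A → Bool) {xs x} → x ∈ filterᵇ p xs → x ∈ xs × p x ≡ true
  ∈-filterᵇ⁻ p x∈ with ∈.∈-filter⁻ (T? ∘ p) x∈
  ... | x∈xs , px = x∈xs , Equivalence.to T-≡ px

  any⁺ : ∀ (p : A → Bool) {xs x} → x ∈ xs → p x ≡ true → any p xs ≡ true
  any⁺ p {y ∷ ys} (here refl) px rewrite px = refl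
  any⁺ p {y ∷ ys} (there x∈) px rewrite any⁺ p x∈ px = ∨-zeroʳ (p y)

  any⁻ : ∀ (p : A → Bool) xs → any p xs ≡ true → ∃ λ x → x ∈ xs × p x ≡ true
  any⁻ p (y ∷ ys) h with p y in py
  ... | true = y , here refl , py
  ... | false = let (x , x∈ , px) = any⁻ p ys h in x , there x∈ , px

  all⁺ : ∀ (p : A → Bool) xs → (∀ x → x ∈ xs → p x ≡ true) → all p xs ≡ true
  all⁺ p [] h = refl
  all⁺ p (y ∷ ys) h rewrite h y (here refl) = all⁺ p ys (λ x x∈ → h x (there x∈))

  all⁻ : ∀ (p : A → Bool) xs → all p xs ≡ true → ∀ {x} → x ∈ xs → p x ≡ true
  all⁻ p (y ∷ ys) h x∈ with p y in py
  all⁻ p (y ∷ ys) h (here refl) | true = py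
  all⁻ p (y ∷ ys) h (there x∈) | true = all⁻ p ys h x∈

  all-false⁻ : ∀ (p : A → Bool) xs → all p xs ≡ false → ∃ λ x → x ∈ xs × p x ≡ false
  all-false⁻ p (y ∷ ys) h with p y in py
  ... | false = y , here refl , py
  ... | true = let (x , x∈ , px) = all-false⁻ p ys h in x , there x∈ , px

  filterᵇ-cong-local : ∀ (p q : A → Bool) xs → (∀ x → x ∈ xs → p x ≡ q x) → filterᵇ p xs ≡ filterᵇ q xs
  filterᵇ-cong-local p q [] h = refl
  filterᵇ-cong-local p q (x ∷ xs) h with p x in px | q x in qx | h x (here refl)
  ... | true | true | _ = cong (x ∷_) (filterᵇ-cong-local p q xs (λ y y∈ → h y (there y∈)))
  ... | false | false | _ = filterᵇ-cong-local p q xs (λ y y∈ → h y (there y∈))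

  module _ (p q : A → Bool) where

    length-filterᵇ-mono : ∀ xs → (∀ x → x ∈ xs → p x ≡ true → q x ≡ true) →
      length (filterᵇ p xs) ≤ length (filterᵇ q xs)
    length-filterᵇ-mono [] p⇒q = z≤n
    length-filterᵇ-mono (y ∷ ys) p⇒q with p y in py | q y in qy | length-filterᵇ-mono ys (λ x x∈ → p⇒q x (there x∈))
    ... | true | true | ih = s≤s ih
    ... | true | false | _ with () ← trans (sym (p⇒q y (here refl) py)) qy
    ... | false | true | ih = ℕ.m≤n⇒m≤1+n ih
    ... | false | false | ih = ih

    length-filterᵇ-<-mono : ∀ xs → (∀ x → x ∈ xs → p x ≡ true → q x ≡ true) →
      ∀ {w} → w ∈ xs → q w ≡ true → p w ≡ false → length (filterᵇ p xs) < length (filterᵇ q xs)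
    length-filterᵇ-<-mono (y ∷ ys) p⇒q (here refl) qw pw rewrite qw | pw =
      s≤s (length-filterᵇ-mono ys (λ x x∈ → p⇒q x (there x∈)))
    length-filterᵇ-<-mono (y ∷ ys) p⇒q (there w∈) qw pw
      with p y in py | q y in qy | length-filterᵇ-<-mono ys (λ x x∈ → p⇒q x (there x∈)) w∈ qw pw
    ... | true | true | ih = s≤s ih
    ... | true | false | _ with () ← trans (sym (p⇒q y (here refl) py)) qy
    ... | false | true | ih = ℕ.m≤n⇒m≤1+n ih
    ... | false | false | ih = ih

boolEq⇒≡ : ∀ {a b} → boolEq a b ≡ true → a ≡ b
boolEq⇒≡ {true} {true} _ = refl
boolEq⇒≡ {false} {false} _ = refl

boolEq-refl : ∀ a → boolEq a a ≡ true
boolEq-refl true = refl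
boolEq-refl false = refl

module _ {A : Set} {eq : A → A → Bool} where

  vecEqᵇ⇒≡ : (∀ {x y} → eq x y ≡ true → x ≡ y) → ∀ {n} {xs ys : Vec A n} → vecEqᵇ eq xs ys ≡ true → xs ≡ ys
  vecEqᵇ⇒≡ eq⇒≡ {xs = []} {[]} _ = refl
  vecEqᵇ⇒≡ eq⇒≡ {xs = x ∷ xs} {y ∷ ys} h with eq x y in exy
  ... | true = cong₂ _∷_ (eq⇒≡ exy) (vecEqᵇ⇒≡ eq⇒≡ h)

  vecEqᵇ-refl : (∀ x → eq x x ≡ true) → ∀ {n} (xs : Vec A n) → vecEqᵇ eq xs xs ≡ true
  vecEqᵇ-refl eq-refl [] = refl
  vecEqᵇ-refl eq-refl (x ∷ xs) rewrite eq-refl x = vecEqᵇ-refl eq-refl xs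

module _ {n : ℕ} where

  subsetEq⇒≡ : ∀ {A B : Subset n} → vecEqᵇ boolEq A B ≡ true → A ≡ B
  subsetEq⇒≡ = vecEqᵇ⇒≡ boolEq⇒≡

  subsetEq-refl : ∀ (A : Subset n) → vecEqᵇ boolEq A A ≡ true
  subsetEq-refl = vecEqᵇ-refl boolEq-refl

  famEqᵇ⇒≡ : ∀ {𝒢 ℋ : List (Subset n)} → famEqᵇ 𝒢 ℋ ≡ true → 𝒢 ≡ ℋ
  famEqᵇ⇒≡ {[]} {[]} _ = refl
  famEqᵇ⇒≡ {G ∷ 𝒢} {H ∷ ℋ} h with vecEqᵇ boolEq G H in eGH
  ... | true = cong₂ _∷_ (subsetEq⇒≡ eGH) (famEqᵇ⇒≡ h)

  famEqᵇ-refl : ∀ (𝒢 : List (Subset n)) → famEqᵇ 𝒢 𝒢 ≡ true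
  famEqᵇ-refl [] = refl
  famEqᵇ-refl (G ∷ 𝒢) rewrite subsetEq-refl G = famEqᵇ-refl 𝒢

  memberᵇ⁺ : ∀ {G : Subset n} {𝒢} → G ∈ 𝒢 → memberᵇ G 𝒢 ≡ true
  memberᵇ⁺ {G} G∈ = any⁺ (vecEqᵇ boolEq G) G∈ (subsetEq-refl G)

  memberᵇ⁻ : ∀ {G : Subset n} 𝒢 → memberᵇ G 𝒢 ≡ true → G ∈ 𝒢
  memberᵇ⁻ {G} 𝒢 h with any⁻ (vecEqᵇ boolEq G) 𝒢 h
  ... | H , H∈ , eGH = subst (_∈ 𝒢) (sym (subsetEq⇒≡ eGH)) H∈

subsetᵇ⇒⊆ : ∀ {n} {A B : Subset n} → subsetᵇ A B ≡ true → A ⊆ B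
subsetᵇ⇒⊆ {A = []} {[]} _ = ⊆-refl
subsetᵇ⇒⊆ {A = true ∷ A} {true ∷ B} h = in⊆in (subsetᵇ⇒⊆ h)
subsetᵇ⇒⊆ {A = true ∷ A} {false ∷ B} ()
subsetᵇ⇒⊆ {A = false ∷ A} {b ∷ B} h = out⊆ (subsetᵇ⇒⊆ h)

⊆⇒subsetᵇ : ∀ {n} {A B : Subset n} → A ⊆ B → subsetᵇ A B ≡ true
⊆⇒subsetᵇ {A = []} {[]} _ = refl
⊆⇒subsetᵇ {A = true ∷ A} {true ∷ B} h = ⊆⇒subsetᵇ (drop-∷-⊆ h)
⊆⇒subsetᵇ {A = true ∷ A} {false ∷ B} h with () ← h Vec.here
⊆⇒subsetᵇ {A = false ∷ A} {b ∷ B} h = ⊆⇒subsetᵇ (drop-∷-⊆ h)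

module _ {A : Set} {eq : A → A → Bool}
  (eq⇒≡ : ∀ {x y} → eq x y ≡ true → x ≡ y) (eq-refl : ∀ x → eq x x ≡ true) where

  ≢⇒eq-false : ∀ {x y} → x ≢ y → eq x y ≡ false
  ≢⇒eq-false {x} {y} x≢y with eq x y in exy
  ... | true = ⊥-elim (x≢y (eq⇒≡ exy))
  ... | false = refl

  ∑-δ : ∀ {xs x} → Unique xs → x ∈ xs → ∀ (g : A → ℤ) → ∑ xs (λ y → 𝟙[ eq y x ] * g y) ≡ g x
  ∑-δ {y ∷ ys} (y∉ys ∷ _) (here refl) g = begin
    𝟙[ eq y y ] * g y + ∑ ys (λ z → 𝟙[ eq z y ] * g z)
      ≡⟨ cong₂ _+_ (cong (λ b → 𝟙[ b ] * g y) (eq-refl y)) (∑-cong-local ys vanish) ⟩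
    + 1 * g y + ∑ ys (λ _ → + 0)
      ≡⟨ cong₂ _+_ (ℤ.*-identityˡ (g y)) (∑-zero ys) ⟩
    g y + + 0
      ≡⟨ ℤ.+-identityʳ (g y) ⟩
    g y ∎
    where
    open ≡-Reasoning
    vanish : ∀ z → z ∈ ys → 𝟙[ eq z y ] * g z ≡ + 0
    vanish z z∈ rewrite ≢⇒eq-false (≢-sym (All.lookup y∉ys z∈)) = ℤ.*-zeroˡ (g z)
  ∑-δ {y ∷ ys} {x} (y∉ys ∷ u) (there x∈) g
    rewrite ≢⇒eq-false (All.lookup y∉ys x∈) | ℤ.*-zeroˡ (g y) =
    trans (ℤ.+-identityˡ _) (∑-δ u x∈ g)

  deduplicateᵇ-unique : ∀ xs → Unique (deduplicateᵇ eq xs)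
  deduplicateᵇ-unique [] = []
  deduplicateᵇ-unique (x ∷ xs) =
    All.map (λ ¬exy x≡y → ¬exy (subst (T ∘ eq x) x≡y (Equivalence.from T-≡ (eq-refl x))))
            (all-filter (¬? ∘ T? ∘ eq x) (deduplicateᵇ eq xs))
    ∷ Unique.filter⁺ (¬? ∘ T? ∘ eq x) (deduplicateᵇ-unique xs)

  ∈-deduplicateᵇ⁺ : ∀ {xs x} → x ∈ xs → x ∈ deduplicateᵇ eq xs
  ∈-deduplicateᵇ⁺ = ∈ˢ.∈-deduplicate⁺ (setoid A) (T? ∘₂ eq)
    (λ Tezy x≡y → trans x≡y (sym (eq⇒≡ (Equivalence.to T-≡ Tezy))))

  ∈-deduplicateᵇ⁻ : ∀ xs {x} → x ∈ deduplicateᵇ eq xs → x ∈ xs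
  ∈-deduplicateᵇ⁻ = ∈.∈-deduplicate⁻ (T? ∘₂ eq)

  ≡⇒eq : ∀ {x y} → x ≡ y → eq x y ≡ true
  ≡⇒eq {x} refl = eq-refl x

  eq-cong-⇔ : ∀ {a b c d} → (a ≡ b → c ≡ d) → (c ≡ d → a ≡ b) → eq a b ≡ eq c d
  eq-cong-⇔ {a} {b} {c} {d} to from with eq a b in eab | eq c d in ecd
  ... | true | true = refl
  ... | false | false = refl
  ... | true | false = trans (sym (≡⇒eq (to (eq⇒≡ eab)))) ecd
  ... | false | true = trans (sym eab) (≡⇒eq (from (eq⇒≡ ecd)))

  ∑-involution : ∀ {xs} → Unique xs → (∀ x → x ∈ xs) → ∀ {Φ : A → A} → (∀ x → Φ (Φ x) ≡ x) →
    ∀ (g : A → ℤ) → ∑ xs (λ x → g (Φ x)) ≡ ∑ xs g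
  -- Both sides are the sum of g y over the pairs (x , y) with y = Φ x.
  ∑-involution {xs} u complete {Φ} ΦΦ g = begin
    ∑ xs (λ x → g (Φ x))
      ≡⟨ ∑-cong xs (λ x → ∑-δ u (complete (Φ x)) g) ⟨
    ∑ xs (λ x → ∑ xs (λ y → 𝟙[ eq y (Φ x) ] * g y))
      ≡⟨ ∑-comm xs xs _ ⟩
    ∑ xs (λ y → ∑ xs (λ x → 𝟙[ eq y (Φ x) ] * g y))
      ≡⟨ ∑-cong xs (λ y → ∑-cong xs (λ x → cong (λ b → 𝟙[ b ] * g y) (flip-Φ x y))) ⟩
    ∑ xs (λ y → ∑ xs (λ x → 𝟙[ eq x (Φ y) ] * g y))
      ≡⟨ ∑-cong xs (λ y → ∑-δ u (complete (Φ y)) (λ _ → g y)) ⟩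
    ∑ xs g ∎
    where
    open ≡-Reasoning
    flip-Φ : ∀ x y → eq y (Φ x) ≡ eq x (Φ y)
    flip-Φ x y = eq-cong-⇔ (λ { refl → sym (ΦΦ x) }) (λ { refl → sym (ΦΦ y) })

-- Möbius functions of finite posets

module Möbius {A : Set} (le eq : A → A → Bool) (ys : List A)
  (eq⇒≡ : ∀ {x y} → eq x y ≡ true → x ≡ y) (eq-refl : ∀ x → eq x x ≡ true)
  where

  P : List A
  P = deduplicateᵇ eq ys

  lt : A → A → Bool
  lt x y = le x y ∧ not (eq x y)

  μ : A → ℤ
  μ = mobiusFromBottom lt P

  module _
    (le-refl : ∀ {x} → x ∈ P → le x x ≡ true)
    (le-trans : ∀ {x y z} → x ∈ P → y ∈ P → z ∈ P → le x y ≡ true → le y z ≡ true → le x z ≡ true)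
    (le-antisym : ∀ {x y} → x ∈ P → y ∈ P → le x y ≡ true → le y x ≡ true → x ≡ y)
    where

    lt-irrefl : ∀ x → lt x x ≡ false
    lt-irrefl x rewrite eq-refl x = ∧-zeroʳ (le x x)

    lt-trans : ∀ {x y z} → x ∈ P → y ∈ P → z ∈ P → lt x y ≡ true → lt y z ≡ true → lt x z ≡ true
    lt-trans {x} {y} {z} x∈ y∈ z∈ x<y y<z
      with le x y in lxy | eq x y in exy | le y z in lyz
    ... | true | false | true rewrite le-trans x∈ y∈ z∈ lxy lyz with eq x z in exz
    ...   | false = refl
    ...   | true with refl ← eq⇒≡ exz
      with () ← trans (sym (≡⇒eq eq⇒≡ eq-refl (le-antisym x∈ y∈ lxy lyz))) exy

    rank : A → ℕ
    rank x = length (filterᵇ (λ y → lt y x) P)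

    rank-< : ∀ {x y} → x ∈ P → y ∈ P → lt y x ≡ true → rank y < rank x
    rank-< {x} {y} x∈ y∈ y<x = length-filterᵇ-<-mono (λ z → lt z y) (λ z → lt z x) P
      (λ z z∈ z<y → lt-trans z∈ y∈ x∈ z<y y<x) y∈ y<x (lt-irrefl y)

    rank<length : ∀ {x} → x ∈ P → rank x < length P
    rank<length {x} x∈ = List.filter-notAll (T? ∘ λ y → lt y x) P
      (Any.map (λ { refl → subst T (lt-irrefl x) }) x∈)

    -- Any fuel above the number of elements below x computes μ x (Defs uses fuel length P).
    fuel-irrelevant : ∀ f f′ {x} → x ∈ P → rank x < f → rank x < f′ →
      mobiusFuel lt P f x ≡ mobiusFuel lt P f′ x
    fuel-irrelevant (suc f) (suc f′) {x} x∈ (s≤s r≤f) (s≤s r≤f′) =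
      cong (λ s → - (+ 1 + s)) (∑-cong-local (filterᵇ (λ y → lt y x) P) λ y y∈ →
        let (y∈P , y<x) = ∈-filterᵇ⁻ (λ y → lt y x) y∈
            ry<rx = rank-< x∈ y∈P y<x in
        fuel-irrelevant f f′ y∈P (ℕ.<-≤-trans ry<rx r≤f) (ℕ.<-≤-trans ry<rx r≤f′))

    μ-recurrence : ∀ {x} → x ∈ P → μ x ≡ - (+ 1 + ∑ (filterᵇ (λ y → lt y x) P) μ)
    μ-recurrence {x} x∈ = begin
      μ x
        ≡⟨ fuel-irrelevant (suc (rank x)) (length P) x∈ (ℕ.n<1+n (rank x)) (rank<length x∈) ⟨
      - (+ 1 + ∑ below (mobiusFuel lt P (rank x)))
        ≡⟨ cong (λ s → - (+ 1 + s)) (∑-cong-local below λ y y∈ →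
             let (y∈P , y<x) = ∈-filterᵇ⁻ (λ y → lt y x) y∈ in
             fuel-irrelevant (rank x) (length P) y∈P (rank-< x∈ y∈P y<x)
               (rank<length y∈P)) ⟩
      - (+ 1 + ∑ below μ) ∎
      where
      open ≡-Reasoning
      below = filterᵇ (λ y → lt y x) P

    -- Σ_{0̂ < y ≤ x} μ(0̂,y) = −μ(0̂,0̂) = −1.
    ∑-μ-downset : ∀ {x} → x ∈ P → ∑ P (λ y → 𝟙[ le y x ] * μ y) ≡ - + 1
    ∑-μ-downset {x} x∈ = begin
      ∑ P (λ y → 𝟙[ le y x ] * μ y)
        ≡⟨ ∑-cong-local P (λ y y∈ →
             trans (cong (_* μ y) (split y y∈)) (ℤ.*-distribʳ-+ (μ y) 𝟙[ lt y x ] 𝟙[ eq y x ])) ⟩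
      ∑ P (λ y → 𝟙[ lt y x ] * μ y + 𝟙[ eq y x ] * μ y)
        ≡⟨ ∑-+ P _ _ ⟩
      ∑ P (λ y → 𝟙[ lt y x ] * μ y) + ∑ P (λ y → 𝟙[ eq y x ] * μ y)
        ≡⟨ cong₂ _+_ (sym (∑-filterᵇ P (λ y → lt y x) μ))
                     (∑-δ eq⇒≡ eq-refl (deduplicateᵇ-unique eq⇒≡ eq-refl ys) x∈ μ) ⟩
      S + μ x
        ≡⟨ cong (_+_ S) (μ-recurrence x∈) ⟩
      S + - (+ 1 + S)
        ≡⟨ cong (_+_ S) (ℤ.neg-distrib-+ (+ 1) S) ⟩
      S + (- + 1 + - S)
        ≡⟨ cong (_+_ S) (ℤ.+-comm (- + 1) (- S)) ⟩
      S + (- S + - + 1)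
        ≡⟨ ℤ.+-assoc S (- S) (- + 1) ⟨
      (S + - S) + - + 1
        ≡⟨ cong (_+ - + 1) (ℤ.+-inverseʳ S) ⟩
      - + 1 ∎
      where
      open ≡-Reasoning
      S = ∑ (filterᵇ (λ y → lt y x) P) μ
      split : ∀ y → y ∈ P → 𝟙[ le y x ] ≡ 𝟙[ lt y x ] + 𝟙[ eq y x ]
      split y y∈ with eq y x in eyx
      ... | true rewrite eq⇒≡ eyx | le-refl x∈ = refl
      ... | false with le y x
      ...   | true = refl
      ...   | false = refl

module _ {n : ℕ} where

  subsetᵇ-refl : ∀ (A : Subset n) → subsetᵇ A A ≡ true
  subsetᵇ-refl A = ⊆⇒subsetᵇ {A = A} (λ x∈ → x∈)

  subsetᵇ-trans : ∀ (A B C : Subset n) → subsetᵇ A B ≡ true → subsetᵇ B C ≡ true → subsetᵇ A C ≡ true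
  subsetᵇ-trans A B C A⊆B B⊆C =
    ⊆⇒subsetᵇ {A = A} (λ x∈ → subsetᵇ⇒⊆ {A = B} {C} B⊆C (subsetᵇ⇒⊆ {A = A} {B} A⊆B x∈))

  subsetᵇ-antisym : ∀ (A B : Subset n) → subsetᵇ A B ≡ true → subsetᵇ B A ≡ true → A ≡ B
  subsetᵇ-antisym A B A⊆B B⊆A = ⊆-antisym (subsetᵇ⇒⊆ {A = A} {B} A⊆B) (subsetᵇ⇒⊆ {A = B} {A} B⊆A)

  unionAll-⊇ : ∀ {S : List (Subset n)} {F} → F ∈ S → subsetᵇ F (unionAll S) ≡ true
  unionAll-⊇ {S} {F} F∈ = ⊆⇒subsetᵇ {A = F} (⊆-unionAll F∈)
    where
    ⊆-unionAll : ∀ {S F} → F ∈ S → F ⊆ unionAll S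
    ⊆-unionAll {F ∷ S} (here refl) = p⊆p∪q (unionAll S)
    ⊆-unionAll {F′ ∷ S} (there F∈) = ⊆-trans (⊆-unionAll F∈) (q⊆p∪q F′ (unionAll S))

  unionAll-lub : ∀ (S : List (Subset n)) C → (∀ {F} → F ∈ S → subsetᵇ F C ≡ true) →
    subsetᵇ (unionAll S) C ≡ true
  unionAll-lub S C bound = ⊆⇒subsetᵇ {A = unionAll S} (lub S (λ {F} F∈ → subsetᵇ⇒⊆ {A = F} (bound F∈)))
    where
    lub : ∀ S → (∀ {F} → F ∈ S → F ⊆ C) → unionAll S ⊆ C
    lub [] _ x∈⊥ = ⊥-elim (∉⊥ x∈⊥)
    lub (F ∷ S) F⊆C x∈ with x∈p∪q⁻ F (unionAll S) x∈
    ... | inj₁ x∈F = F⊆C (here refl) x∈F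
    ... | inj₂ x∈⋃S = lub S (F⊆C ∘ there) x∈⋃S

subset-ofSize : ∀ {n} (A : Subset n) m → m ≤ ∣ A ∣ → ∃ λ F → ∣ F ∣ ≡ m × subsetᵇ F A ≡ true
subset-ofSize {n} A zero _ = ⊥ , ∣⊥∣≡0 n , ⊆⇒subsetᵇ {A = ⊥} {A} ⊥⊆
subset-ofSize (true ∷ A) (suc m) (s≤s m≤∣A∣) =
  let (F , ∣F∣≡m , F⊆A) = subset-ofSize A m m≤∣A∣ in true ∷ F , cong suc ∣F∣≡m , F⊆A
subset-ofSize (false ∷ A) (suc m) m≤∣A∣ =
  let (F , ∣F∣≡m , F⊆A) = subset-ofSize A (suc m) m≤∣A∣ in false ∷ F , ∣F∣≡m , F⊆A

subsetᵇ-∩⁺ : ∀ {n} (F A B : Subset n) → subsetᵇ F A ≡ true → subsetᵇ F B ≡ true → subsetᵇ F (A ∩ B) ≡ true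
subsetᵇ-∩⁺ F A B F⊆A F⊆B =
  ⊆⇒subsetᵇ {A = F} (λ x∈ → x∈p∩q⁺ (subsetᵇ⇒⊆ {A = F} F⊆A x∈ , subsetᵇ⇒⊆ {A = F} F⊆B x∈))

subsetᵇ-∩⁻ : ∀ {n} (F A B : Subset n) → subsetᵇ F (A ∩ B) ≡ true → subsetᵇ F A ≡ true × subsetᵇ F B ≡ true
subsetᵇ-∩⁻ F A B F⊆A∩B =
  ⊆⇒subsetᵇ {A = F} (p∩q⊆p A B ∘ subsetᵇ⇒⊆ {A = F} F⊆A∩B) ,
  ⊆⇒subsetᵇ {A = F} (p∩q⊆q A B ∘ subsetᵇ⇒⊆ {A = F} F⊆A∩B)

subsetᵇ⇒∣∣≤ : ∀ {n} (A B : Subset n) → subsetᵇ A B ≡ true → ∣ A ∣ ≤ ∣ B ∣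
subsetᵇ⇒∣∣≤ A B A⊆B = p⊆q⇒∣p∣≤∣q∣ (subsetᵇ⇒⊆ {A = A} A⊆B)

module _ {A : Set} where

  filterᵇ∈sublists : ∀ (p : A → Bool) xs → filterᵇ p xs ∈ sublists xs
  filterᵇ∈sublists p [] = here refl
  filterᵇ∈sublists p (x ∷ xs) with p x
  ... | true = ∈.∈-++⁺ʳ (sublists xs) (∈.∈-map⁺ (x ∷_) (filterᵇ∈sublists p xs))
  ... | false = ∈.∈-++⁺ˡ (filterᵇ∈sublists p xs)

  ∈-sublists⇒⊆ : ∀ xs {S} → S ∈ sublists xs → ∀ {x : A} → x ∈ S → x ∈ xs
  ∈-sublists⇒⊆ [] (here refl) ()
  ∈-sublists⇒⊆ (y ∷ ys) S∈ x∈ with ∈.∈-++⁻ (sublists ys) S∈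
  ... | inj₁ S∈′ = there (∈-sublists⇒⊆ ys S∈′ x∈)
  ... | inj₂ S∈′ with ∈.∈-map⁻ (y ∷_) S∈′
  ...   | S′ , S′∈ , refl with x∈
  ...     | here refl = here refl
  ...     | there x∈S′ = there (∈-sublists⇒⊆ ys S′∈ x∈S′)

-- Enumerating subsets and counting supersets

module _ {A : Set} {k : ℕ} where

  prefixAll : List A → List (Vec A k) → List (Vec A (suc k))
  prefixAll heads xs = concatMap (λ s → map (s ∷_) xs) heads

  ∈-prefixAll : ∀ heads xs {s v} → s ∈ heads → v ∈ xs → (s ∷ v) ∈ prefixAll heads xs
  ∈-prefixAll (s ∷ _) xs (here refl) v∈ = ∈.∈-++⁺ˡ (∈.∈-map⁺ (s ∷_) v∈)
  ∈-prefixAll (s′ ∷ heads) xs (there s∈) v∈ = ∈.∈-++⁺ʳ (map (s′ ∷_) xs) (∈-prefixAll heads xs s∈ v∈)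

  head-∈-prefixAll : ∀ heads {xs v} → v ∈ prefixAll heads xs → Vec.head v ∈ heads
  head-∈-prefixAll (s ∷ heads) {xs} v∈ with ∈.∈-++⁻ (map (s ∷_) xs) v∈
  ... | inj₁ v∈sxs with ∈.∈-map⁻ (s ∷_) v∈sxs
  ...   | _ , _ , refl = here refl
  head-∈-prefixAll (s ∷ heads) v∈ | inj₂ v∈rest = there (head-∈-prefixAll heads v∈rest)

  prefixAll-unique : ∀ heads xs → Unique heads → Unique xs → Unique (prefixAll heads xs)
  prefixAll-unique [] xs _ _ = []
  prefixAll-unique (s ∷ heads) xs (s∉heads ∷ u) uxs =
    Unique.++⁺ (Unique.map⁺ Vec.∷-injectiveʳ uxs) (prefixAll-unique heads xs u uxs) disjoint
    where
    disjoint : ∀ {v} → ¬ (v ∈ map (s ∷_) xs × v ∈ prefixAll heads xs)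
    disjoint (v∈sxs , v∈rest) with ∈.∈-map⁻ (s ∷_) v∈sxs
    ... | _ , _ , refl = All.lookup s∉heads (head-∈-prefixAll heads v∈rest) refl

∈-allSubsets : ∀ n (X : Subset n) → X ∈ allSubsets n
∈-allSubsets zero [] = here refl
∈-allSubsets (suc n) (false ∷ X) = ∈-prefixAll (false ∷ true ∷ []) (allSubsets n) (here refl) (∈-allSubsets n X)
∈-allSubsets (suc n) (true ∷ X) = ∈-prefixAll (false ∷ true ∷ []) (allSubsets n) (there (here refl)) (∈-allSubsets n X)

allSubsets-unique : ∀ n → Unique (allSubsets n)
allSubsets-unique zero = [] ∷ []
allSubsets-unique (suc n) =
  prefixAll-unique (false ∷ true ∷ []) (allSubsets n) (((λ ()) ∷ []) ∷ [] ∷ []) (allSubsets-unique n)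

∑-allSubsets-suc : ∀ n (f : Subset (suc n) → ℤ) →
  ∑ (allSubsets (suc n)) f ≡ ∑ (allSubsets n) (λ K → f (false ∷ K)) + ∑ (allSubsets n) (λ K → f (true ∷ K))
∑-allSubsets-suc n f = begin
  ∑ (map (false ∷_) S ++ map (true ∷_) S ++ []) f
    ≡⟨ ∑-++ (map (false ∷_) S) _ f ⟩
  ∑ (map (false ∷_) S) f + ∑ (map (true ∷_) S ++ []) f
    ≡⟨ cong (λ Ks → ∑ (map (false ∷_) S) f + ∑ Ks f) (List.++-identityʳ (map (true ∷_) S)) ⟩
  ∑ (map (false ∷_) S) f + ∑ (map (true ∷_) S) f
    ≡⟨ cong₂ _+_ (∑-map (false ∷_) S f) (∑-map (true ∷_) S f) ⟩
  ∑ S (λ K → f (false ∷ K)) + ∑ S (λ K → f (true ∷ K)) ∎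
  where
  open ≡-Reasoning
  S = allSubsets n

supersetCount : ∀ n → Subset n → ℕ → ℤ
supersetCount n G ℓ = ∑ (allSubsets n) (λ K → 𝟙[ (∣ K ∣ ≡ᵇ ℓ) ∧ subsetᵇ G K ])

supersetCount-large : ∀ n (G : Subset n) ℓ → ℓ < ∣ G ∣ → supersetCount n G ℓ ≡ + 0
supersetCount-large n G ℓ ℓ<∣G∣ = trans (∑-cong (allSubsets n) none) (∑-zero (allSubsets n))
  where
  none : ∀ K → 𝟙[ (∣ K ∣ ≡ᵇ ℓ) ∧ subsetᵇ G K ] ≡ + 0
  none K with ∣ K ∣ ≡ᵇ ℓ in ∣K∣≡ℓ | subsetᵇ G K in G⊆K
  ... | false | _ = refl
  ... | true | false = refl
  ... | true | true = ⊥-elim (ℕ.<⇒≱ ℓ<∣G∣ (subst (∣ G ∣ ≤_) (ℕ.≡ᵇ⇒≡ _ _ (Equivalence.from T-≡ ∣K∣≡ℓ))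
                       (p⊆q⇒∣p∣≤∣q∣ (subsetᵇ⇒⊆ {A = G} G⊆K))))

supersetCount-binomial : ∀ n (G : Subset n) ℓ → ∣ G ∣ ≤ ℓ →
  supersetCount n G ℓ ≡ + ((n ∸ ∣ G ∣) C (ℓ ∸ ∣ G ∣))
supersetCount-binomial zero [] zero _ = refl
supersetCount-binomial zero [] (suc ℓ) _ = refl
supersetCount-binomial (suc n) (true ∷ G) (suc ℓ) (s≤s ∣G∣≤ℓ) = begin
  supersetCount (suc n) (true ∷ G) (suc ℓ)
    ≡⟨ ∑-allSubsets-suc n _ ⟩
  ∑ (allSubsets n) (λ K → 𝟙[ (∣ K ∣ ≡ᵇ suc ℓ) ∧ false ]) + supersetCount n G ℓ
    ≡⟨ cong (_+ supersetCount n G ℓ)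
         (trans (∑-cong (allSubsets n) (λ K → cong 𝟙[_] (∧-zeroʳ (∣ K ∣ ≡ᵇ suc ℓ)))) (∑-zero (allSubsets n))) ⟩
  + 0 + supersetCount n G ℓ
    ≡⟨ ℤ.+-identityˡ _ ⟩
  supersetCount n G ℓ
    ≡⟨ supersetCount-binomial n G ℓ ∣G∣≤ℓ ⟩
  + ((n ∸ ∣ G ∣) C (ℓ ∸ ∣ G ∣)) ∎
  where open ≡-Reasoning
supersetCount-binomial (suc n) (false ∷ G) zero ∣G∣≤0 = begin
  supersetCount (suc n) (false ∷ G) 0
    ≡⟨ ∑-allSubsets-suc n _ ⟩
  supersetCount n G 0 + ∑ (allSubsets n) (λ _ → + 0)
    ≡⟨ cong₂ _+_ (supersetCount-binomial n G 0 ∣G∣≤0) (∑-zero (allSubsets n)) ⟩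
  + ((n ∸ g) C (0 ∸ g)) + + 0
    ≡⟨ cong (λ j → + ((n ∸ g) C j) + + 0) (ℕ.0∸n≡0 g) ⟩
  + 1
    ≡⟨ cong (λ j → + ((suc n ∸ g) C j)) (ℕ.0∸n≡0 g) ⟨
  + ((suc n ∸ g) C (0 ∸ g)) ∎
  where
  open ≡-Reasoning
  g = ∣ G ∣
supersetCount-binomial (suc n) (false ∷ G) (suc ℓ) ∣G∣≤1+ℓ with ∣ G ∣ ℕ.≤? ℓ
... | yes ∣G∣≤ℓ = begin
  supersetCount (suc n) (false ∷ G) (suc ℓ)
    ≡⟨ ∑-allSubsets-suc n _ ⟩
  supersetCount n G (suc ℓ) + supersetCount n G ℓ
    ≡⟨ cong₂ _+_ (supersetCount-binomial n G (suc ℓ) ∣G∣≤1+ℓ) (supersetCount-binomial n G ℓ ∣G∣≤ℓ) ⟩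
  + ((n ∸ g) C (suc ℓ ∸ g)) + + ((n ∸ g) C (ℓ ∸ g))
    ≡⟨ cong (λ j → + ((n ∸ g) C j ℕ.+ (n ∸ g) C (ℓ ∸ g))) (ℕ.+-∸-assoc 1 ∣G∣≤ℓ) ⟩
  + ((n ∸ g) C suc (ℓ ∸ g) ℕ.+ (n ∸ g) C (ℓ ∸ g))
    ≡⟨ cong +_ (trans (ℕ.+-comm ((n ∸ g) C suc (ℓ ∸ g)) _) (nCk+nC[k+1]≡[n+1]C[k+1] (n ∸ g) (ℓ ∸ g))) ⟩
  + (suc (n ∸ g) C suc (ℓ ∸ g))
    ≡⟨ cong₂ (λ i j → + (i C j)) (ℕ.+-∸-assoc 1 (∣p∣≤n G)) (ℕ.+-∸-assoc 1 ∣G∣≤ℓ) ⟨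
  + ((suc n ∸ g) C (suc ℓ ∸ g)) ∎
  where
  open ≡-Reasoning
  g = ∣ G ∣
... | no ∣G∣≰ℓ = begin
  supersetCount (suc n) (false ∷ G) (suc ℓ)
    ≡⟨ ∑-allSubsets-suc n _ ⟩
  supersetCount n G (suc ℓ) + supersetCount n G ℓ
    ≡⟨ cong₂ _+_ (supersetCount-binomial n G (suc ℓ) ∣G∣≤1+ℓ) (supersetCount-large n G ℓ (ℕ.≰⇒> ∣G∣≰ℓ)) ⟩
  + ((n ∸ g) C (suc ℓ ∸ g)) + + 0
    ≡⟨ cong (λ j → + ((n ∸ g) C j) + + 0) 1+ℓ∸g≡0 ⟩
  + 1
    ≡⟨ cong (λ j → + ((suc n ∸ g) C j)) 1+ℓ∸g≡0 ⟨
  + ((suc n ∸ g) C (suc ℓ ∸ g)) ∎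
  where
  open ≡-Reasoning
  g = ∣ G ∣
  1+ℓ∸g≡0 : suc ℓ ∸ g ≡ 0
  1+ℓ∸g≡0 = ℕ.m≤n⇒m∸n≡0 (ℕ.≰⇒> ∣G∣≰ℓ)

-- The union poset 𝓔(𝒢)

containsSomeᵇ : ∀ {n} → Subset n → List (Subset n) → Bool
containsSomeᵇ K 𝒢 = any (λ F → subsetᵇ F K) 𝒢

module UnionClosure {n : ℕ} (𝒢 : List (Subset n)) where

  open Möbius subsetᵇ (vecEqᵇ boolEq) (map unionAll (filterᵇ nonEmptyᵇ (sublists 𝒢)))
    subsetEq⇒≡ subsetEq-refl using (μ; ∑-μ-downset)

  ∈-posetE⁻ : ∀ {G} → G ∈ posetE 𝒢 → ∃ λ S → S ∈ sublists 𝒢 × nonEmptyᵇ S ≡ true × G ≡ unionAll S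
  ∈-posetE⁻ G∈ with ∈.∈-map⁻ unionAll (∈-deduplicateᵇ⁻ subsetEq⇒≡ subsetEq-refl _ G∈)
  ... | S , S∈ , refl = let (S∈′ , ne) = ∈-filterᵇ⁻ nonEmptyᵇ S∈ in S , S∈′ , ne , refl

  ∈-posetE⁺ : ∀ {S} → S ∈ sublists 𝒢 → nonEmptyᵇ S ≡ true → unionAll S ∈ posetE 𝒢
  ∈-posetE⁺ S∈ ne = ∈-deduplicateᵇ⁺ subsetEq⇒≡ subsetEq-refl (∈.∈-map⁺ unionAll (∈-filterᵇ⁺ nonEmptyᵇ S∈ ne))

  posetE-⊇-member : ∀ {G} → G ∈ posetE 𝒢 → ∃ λ F → F ∈ 𝒢 × subsetᵇ F G ≡ true
  posetE-⊇-member G∈ with ∈-posetE⁻ G∈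
  ... | F ∷ S , S∈ , _ , refl = F , ∈-sublists⇒⊆ 𝒢 S∈ (here refl) , unionAll-⊇ {S = F ∷ S} (here refl)

  ∑-μ-⊆ : ∀ K → ∑ (posetE 𝒢) (λ G → 𝟙[ subsetᵇ G K ] * μ G) ≡ - 𝟙[ containsSomeᵇ K 𝒢 ]
  ∑-μ-⊆ K with containsSomeᵇ K 𝒢 in hit
  ... | false = trans (∑-cong-local (posetE 𝒢) vanish) (∑-zero (posetE 𝒢))
    where
    vanish : ∀ G → G ∈ posetE 𝒢 → 𝟙[ subsetᵇ G K ] * μ G ≡ + 0
    vanish G G∈ with subsetᵇ G K in G⊆K | posetE-⊇-member G∈
    ... | false | _ = refl
    ... | true | F , F∈ , F⊆G with () ← trans (sym (any⁺ (λ F → subsetᵇ F K) F∈ (subsetᵇ-trans F G K F⊆G G⊆K))) hit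
  ... | true = trans (∑-cong-local (posetE 𝒢) λ G G∈ → cong (λ b → 𝟙[ b ] * μ G) (⊆K⇔⊆M G∈))
      (∑-μ-downset (λ {G} _ → subsetᵇ-refl G) (λ {A} {B} {C} _ _ _ → subsetᵇ-trans A B C)
                   (λ {A} {B} _ _ → subsetᵇ-antisym A B) M∈)
    where
    inside = filterᵇ (λ F → subsetᵇ F K) 𝒢
    M = unionAll inside
    M∈ : M ∈ posetE 𝒢
    M∈ = ∈-posetE⁺ (filterᵇ∈sublists (λ F → subsetᵇ F K) 𝒢) (nonempty 𝒢 hit)
      where
      nonempty : ∀ ℋ → any (λ F → subsetᵇ F K) ℋ ≡ true → nonEmptyᵇ (filterᵇ (λ F → subsetᵇ F K) ℋ) ≡ true
      nonempty (F ∷ ℋ) h with subsetᵇ F K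
      ... | true = refl
      ... | false = nonempty ℋ h
    M⊆K : subsetᵇ M K ≡ true
    M⊆K = unionAll-lub inside K (λ F∈ → proj₂ (∈-filterᵇ⁻ (λ F → subsetᵇ F K) {𝒢} F∈))
    ⊆K⇔⊆M : ∀ {G} → G ∈ posetE 𝒢 → subsetᵇ G K ≡ subsetᵇ G M
    ⊆K⇔⊆M G∈ with ∈-posetE⁻ G∈
    ... | S , S∈ , _ , refl = ≡true-⇔⇒≡
      (λ ⋃S⊆K → unionAll-lub S M λ {F} F∈ →
         unionAll-⊇ (∈-filterᵇ⁺ (λ F → subsetᵇ F K) (∈-sublists⇒⊆ 𝒢 S∈ F∈)
                                 (subsetᵇ-trans F (unionAll S) K (unionAll-⊇ F∈) ⋃S⊆K)))
      (λ ⋃S⊆M → subsetᵇ-trans (unionAll S) M K ⋃S⊆M M⊆K)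

  unionSum : ℕ → ℤ
  unionSum ℓ = ∑ (filterᵇ (λ G → (0 <ᵇ ∣ G ∣) ∧ (∣ G ∣ ≤ᵇ ℓ)) (posetE 𝒢))
    (λ G → μ G * + ((n ∸ ∣ G ∣) C (ℓ ∸ ∣ G ∣)))

  unionSum-containsSome : (∀ {F} → F ∈ 𝒢 → 0 < ∣ F ∣) → ∀ ℓ →
    unionSum ℓ ≡ ∑ (allSubsets n) (λ K → 𝟙[ ∣ K ∣ ≡ᵇ ℓ ] * - 𝟙[ containsSomeᵇ K 𝒢 ])
  unionSum-containsSome 𝒢-nonempty ℓ = begin
    unionSum ℓ
      ≡⟨ ∑-filterᵇ E small (λ G → μ G * + binom G) ⟩
    ∑ E (λ G → 𝟙[ small G ] * (μ G * + binom G))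
      ≡⟨ ∑-cong-local E count ⟩
    ∑ E (λ G → μ G * supersetCount n G ℓ)
      ≡⟨ ∑-cong E (λ G → ∑-*ˡ S (μ G) _) ⟨
    ∑ E (λ G → ∑ S (λ K → μ G * 𝟙[ (∣ K ∣ ≡ᵇ ℓ) ∧ subsetᵇ G K ]))
      ≡⟨ ∑-comm E S _ ⟩
    ∑ S (λ K → ∑ E (λ G → μ G * 𝟙[ (∣ K ∣ ≡ᵇ ℓ) ∧ subsetᵇ G K ]))
      ≡⟨ ∑-cong S (λ K → trans (∑-cong E (regroup K)) (∑-*ˡ E 𝟙[ ∣ K ∣ ≡ᵇ ℓ ] _)) ⟩
    ∑ S (λ K → 𝟙[ ∣ K ∣ ≡ᵇ ℓ ] * ∑ E (λ G → 𝟙[ subsetᵇ G K ] * μ G))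
      ≡⟨ ∑-cong S (λ K → cong (𝟙[ ∣ K ∣ ≡ᵇ ℓ ] *_) (∑-μ-⊆ K)) ⟩
    ∑ S (λ K → 𝟙[ ∣ K ∣ ≡ᵇ ℓ ] * - 𝟙[ containsSomeᵇ K 𝒢 ]) ∎
    where
    open ≡-Reasoning
    S = allSubsets n
    E = posetE 𝒢
    small : Subset n → Bool
    small G = (0 <ᵇ ∣ G ∣) ∧ (∣ G ∣ ≤ᵇ ℓ)
    binom : Subset n → ℕ
    binom G = (n ∸ ∣ G ∣) C (ℓ ∸ ∣ G ∣)
    positive : ∀ {G} → G ∈ E → 0 < ∣ G ∣
    positive {G} G∈ = let (F , F∈ , F⊆G) = posetE-⊇-member G∈ in
      ℕ.<-≤-trans (𝒢-nonempty F∈) (subsetᵇ⇒∣∣≤ F G F⊆G)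
    count : ∀ G → G ∈ E → 𝟙[ small G ] * (μ G * + binom G) ≡ μ G * supersetCount n G ℓ
    count G G∈ rewrite Equivalence.to T-≡ (ℕ.<⇒<ᵇ (positive G∈)) with ∣ G ∣ ≤ᵇ ℓ in ∣G∣≤ℓ
    ... | true = trans (ℤ.*-identityˡ _)
      (cong (μ G *_) (sym (supersetCount-binomial n G ℓ (ℕ.≤ᵇ⇒≤ _ _ (Equivalence.from T-≡ ∣G∣≤ℓ)))))
    ... | false = trans (ℤ.*-zeroˡ (μ G * + binom G))
                        (sym (trans (cong (μ G *_) (supersetCount-large n G ℓ ℓ<∣G∣)) (ℤ.*-zeroʳ (μ G))))
      where
      ℓ<∣G∣ : ℓ < ∣ G ∣
      ℓ<∣G∣ = ℕ.≰⇒> (λ ∣G∣≤ℓ′ → subst T ∣G∣≤ℓ (ℕ.≤⇒≤ᵇ ∣G∣≤ℓ′))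
    regroup : ∀ K G → μ G * 𝟙[ (∣ K ∣ ≡ᵇ ℓ) ∧ subsetᵇ G K ] ≡ 𝟙[ ∣ K ∣ ≡ᵇ ℓ ] * (𝟙[ subsetᵇ G K ] * μ G)
    regroup K G with ∣ K ∣ ≡ᵇ ℓ
    ... | true = trans (ℤ.*-comm (μ G) _) (sym (ℤ.*-identityˡ _))
    ... | false = trans (ℤ.*-zeroʳ (μ G)) (sym (ℤ.*-zeroˡ (𝟙[ subsetᵇ G K ] * μ G)))

⌈1+ℓ/2⌉≤x⇒ℓ<2x : ∀ ℓ x → ⌈ suc ℓ /2⌉ ≤ x → ℓ < 2 ℕ.* x
⌈1+ℓ/2⌉≤x⇒ℓ<2x zero (suc x) _ = s≤s z≤n
⌈1+ℓ/2⌉≤x⇒ℓ<2x (suc zero) (suc x) _ rewrite ℕ.+-suc x (x ℕ.+ 0) = s≤s (s≤s z≤n)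
⌈1+ℓ/2⌉≤x⇒ℓ<2x (suc (suc ℓ)) (suc x) (s≤s h) rewrite ℕ.+-suc x (x ℕ.+ 0) = s≤s (s≤s (⌈1+ℓ/2⌉≤x⇒ℓ<2x ℓ x h))

ℓ<2x⇒⌈1+ℓ/2⌉≤x : ∀ ℓ x → ℓ < 2 ℕ.* x → ⌈ suc ℓ /2⌉ ≤ x
ℓ<2x⇒⌈1+ℓ/2⌉≤x zero (suc x) _ = s≤s z≤n
ℓ<2x⇒⌈1+ℓ/2⌉≤x (suc zero) (suc x) _ = s≤s z≤n
ℓ<2x⇒⌈1+ℓ/2⌉≤x (suc (suc ℓ)) (suc x) h rewrite ℕ.+-suc x (x ℕ.+ 0) =
  s≤s (ℓ<2x⇒⌈1+ℓ/2⌉≤x ℓ x (ℕ.≤-pred (ℕ.≤-pred h)))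

nonempty⇒member : ∀ {t} (E : Subset t) → (0 <ᵇ ∣ E ∣) ≡ true → ∃ λ e → lookup E e ≡ true
nonempty⇒member (true ∷ E) _ = zero , refl
nonempty⇒member (false ∷ E) h = let (e , e∈E) = nonempty⇒member E h in suc e , e∈E

member⇒nonempty : ∀ {t} (E : Subset t) e → lookup E e ≡ true → (0 <ᵇ ∣ E ∣) ≡ true
member⇒nonempty (true ∷ E) e _ = refl
member⇒nonempty (false ∷ E) (suc e) e∈E = member⇒nonempty E e e∈E

famSubᵇ : ∀ {n} → List (Subset n) → List (Subset n) → Bool
famSubᵇ 𝒢 ℋ = all (λ G → memberᵇ G ℋ) 𝒢

module _ {n : ℕ} where

  famSubᵇ-refl : ∀ (𝒢 : List (Subset n)) → famSubᵇ 𝒢 𝒢 ≡ true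
  famSubᵇ-refl 𝒢 = all⁺ _ 𝒢 λ G G∈ → memberᵇ⁺ G∈

  famSubᵇ-trans : ∀ (𝒢 ℋ 𝒦 : List (Subset n)) → famSubᵇ 𝒢 ℋ ≡ true → famSubᵇ ℋ 𝒦 ≡ true → famSubᵇ 𝒢 𝒦 ≡ true
  famSubᵇ-trans 𝒢 ℋ 𝒦 𝒢⊆ℋ ℋ⊆𝒦 = all⁺ _ 𝒢 λ G G∈ →
    all⁻ (λ H → memberᵇ H 𝒦) ℋ ℋ⊆𝒦 (memberᵇ⁻ {G = G} ℋ (all⁻ (λ H → memberᵇ H ℋ) 𝒢 𝒢⊆ℋ G∈))

-- The committee count and the formula for an arbitrary family P e ⊆ Fin n in place of 𝒯⁺_e;
-- at P = Tplus L they are numCommittees L and committeeFormula L by definition.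
module Committees {t n : ℕ} (P : Fin t → Subset n) where

  family : ℕ → Subset t → List (Subset n)
  family m E = filterᵇ
    (λ G → (∣ G ∣ ≡ᵇ m) ∧ any (λ e → lookup E e ∧ subsetᵇ G (P e)) (allFin t))
    (allSubsets n)

  nonemptyIndices : List (Subset t)
  nonemptyIndices = filterᵇ (λ E → 0 <ᵇ ∣ E ∣) (allSubsets t)

  familyPoset : ℕ → List (List (Subset n))
  familyPoset ℓ = deduplicateᵇ famEqᵇ (map (family ⌈ suc ℓ /2⌉) nonemptyIndices)

  mobiusFormula : ℕ → ℤ
  mobiusFormula ℓ = ∑ (familyPoset ℓ)
    (λ 𝒢 → mobiusFromBottom famStrictSubᵇ (familyPoset ℓ) 𝒢 * UnionClosure.unionSum 𝒢 ℓ)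

  isCommittee : ℕ → Subset n → Bool
  isCommittee k K = (∣ K ∣ ≡ᵇ k) ∧ all (λ e → k <ᵇ (2 ℕ.* ∣ K ∩ P e ∣)) (allFin t)

  committeeCount : ℕ → ℕ
  committeeCount k = length (filterᵇ (isCommittee k) (allSubsets n))

  module _ (ℓ : ℕ) where

    m : ℕ
    m = ⌈ suc ℓ /2⌉

    inFamily : Subset t → Subset n → Bool
    inFamily E G = (∣ G ∣ ≡ᵇ m) ∧ any (λ e → lookup E e ∧ subsetᵇ G (P e)) (allFin t)

    ∈-family⁺ : ∀ E G e → ∣ G ∣ ≡ m → lookup E e ≡ true → subsetᵇ G (P e) ≡ true → G ∈ family m E
    ∈-family⁺ E G e ∣G∣≡m e∈E G⊆Pe = ∈-filterᵇ⁺ (inFamily E) (∈-allSubsets n G) G∈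
      where
      G∈ : inFamily E G ≡ true
      G∈ rewrite ∣G∣≡m | Equivalence.to T-≡ (ℕ.≡⇒≡ᵇ m m refl) =
        any⁺ (λ e → lookup E e ∧ subsetᵇ G (P e)) (∈.∈-allFin e) (cong₂ _∧_ e∈E G⊆Pe)

    ∈-family⁻ : ∀ {E G} → G ∈ family m E →
      ∣ G ∣ ≡ m × ∃ λ e → lookup E e ≡ true × subsetᵇ G (P e) ≡ true
    ∈-family⁻ {E} {G} G∈ with ∈-filterᵇ⁻ (inFamily E) {allSubsets n} G∈
    ... | _ , G∈′ with ∣ G ∣ ≡ᵇ m in ∣G∣≡m
    ...   | true with any⁻ _ (allFin t) G∈′
    ...     | e , _ , e∈E∧G⊆Pe with lookup E e in e∈E | subsetᵇ G (P e) in G⊆Pe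
    ...       | true | true = ℕ.≡ᵇ⇒≡ _ _ (Equivalence.from T-≡ ∣G∣≡m) , e , e∈E , G⊆Pe

    ∈-familyPoset⁻ : ∀ {𝒢} → 𝒢 ∈ familyPoset ℓ → ∃ λ E → (0 <ᵇ ∣ E ∣) ≡ true × 𝒢 ≡ family m E
    ∈-familyPoset⁻ 𝒢∈ with ∈.∈-map⁻ (family m) (∈-deduplicateᵇ⁻ famEqᵇ⇒≡ famEqᵇ-refl _ 𝒢∈)
    ... | E , E∈ , refl = E , proj₂ (∈-filterᵇ⁻ (λ E → 0 <ᵇ ∣ E ∣) {allSubsets t} E∈) , refl

    ∈-familyPoset⁺ : ∀ E → (0 <ᵇ ∣ E ∣) ≡ true → family m E ∈ familyPoset ℓ
    ∈-familyPoset⁺ E E≠∅ = ∈-deduplicateᵇ⁺ famEqᵇ⇒≡ famEqᵇ-refl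
      (∈.∈-map⁺ (family m) (∈-filterᵇ⁺ (λ E → 0 <ᵇ ∣ E ∣) (∈-allSubsets t E) E≠∅))

    -- family m E lists its members in the order of allSubsets, so mutual inclusion forces equal lists.
    family-antisym : ∀ E E′ → famSubᵇ (family m E) (family m E′) ≡ true → famSubᵇ (family m E′) (family m E) ≡ true →
      family m E ≡ family m E′
    family-antisym E E′ ⊆′ ⊇′ = filterᵇ-cong-local (inFamily E) (inFamily E′) (allSubsets n) λ G _ →
      ≡true-⇔⇒≡ (moves {E} {E′} {G} ⊆′) (moves {E′} {E} {G} ⊇′)
      where
      moves : ∀ {E E′ G} → famSubᵇ (family m E) (family m E′) ≡ true → inFamily E G ≡ true → inFamily E′ G ≡ true
      moves {E} {E′} {G} ⊆′ G∈ = proj₂ (∈-filterᵇ⁻ (inFamily E′) {allSubsets n}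
        (memberᵇ⁻ {G = G} (family m E′) (all⁻ (λ H → memberᵇ H (family m E′)) (family m E) ⊆′
          (∈-filterᵇ⁺ (inFamily E) (∈-allSubsets n G) G∈))))

    open Möbius famSubᵇ famEqᵇ (map (family m) nonemptyIndices) famEqᵇ⇒≡ famEqᵇ-refl
      using (∑-μ-downset) renaming (μ to μC)

    ∑-μC-downset : ∀ {𝒳} → 𝒳 ∈ familyPoset ℓ → ∑ (familyPoset ℓ) (λ 𝒢 → 𝟙[ famSubᵇ 𝒢 𝒳 ] * μC 𝒢) ≡ - + 1
    ∑-μC-downset = ∑-μ-downset (λ {𝒢} _ → famSubᵇ-refl 𝒢) (λ {𝒢} {ℋ} {𝒦} _ _ _ → famSubᵇ-trans 𝒢 ℋ 𝒦) antisym
      where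
      antisym : ∀ {𝒢 ℋ} → 𝒢 ∈ familyPoset ℓ → ℋ ∈ familyPoset ℓ →
        famSubᵇ 𝒢 ℋ ≡ true → famSubᵇ ℋ 𝒢 ≡ true → 𝒢 ≡ ℋ
      antisym 𝒢∈ ℋ∈ with ∈-familyPoset⁻ 𝒢∈ | ∈-familyPoset⁻ ℋ∈
      ... | E , _ , refl | E′ , _ , refl = family-antisym E E′

    good : Subset n → Fin t → Bool
    good K e = ℓ <ᵇ 2 ℕ.* ∣ K ∩ P e ∣

    bad : Subset n → Subset t
    bad K = tabulate (not ∘ good K)

    good⇒containsSome : ∀ K {E} e → lookup E e ≡ true → good K e ≡ true → containsSomeᵇ K (family m E) ≡ true
    good⇒containsSome K {E} e e∈E e-good with subset-ofSize (K ∩ P e) m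
      (ℓ<2x⇒⌈1+ℓ/2⌉≤x ℓ _ (ℕ.<ᵇ⇒< ℓ _ (Equivalence.from T-≡ e-good)))
    ... | F , ∣F∣≡m , F⊆K∩Pe = let (F⊆K , F⊆Pe) = subsetᵇ-∩⁻ F K (P e) F⊆K∩Pe in
      any⁺ (λ F → subsetᵇ F K) (∈-family⁺ E F e ∣F∣≡m e∈E F⊆Pe) F⊆K

    m-subset⇒good : ∀ K e F → ∣ F ∣ ≡ m → subsetᵇ F K ≡ true → subsetᵇ F (P e) ≡ true → good K e ≡ true
    m-subset⇒good K e F ∣F∣≡m F⊆K F⊆Pe = Equivalence.to T-≡ (ℕ.<⇒<ᵇ (⌈1+ℓ/2⌉≤x⇒ℓ<2x ℓ _
      (subst (_≤ ∣ K ∩ P e ∣) ∣F∣≡m (subsetᵇ⇒∣∣≤ F (K ∩ P e) (subsetᵇ-∩⁺ F K (P e) F⊆K F⊆Pe)))))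

    lookup-bad : ∀ K e → lookup (bad K) e ≡ not (good K e)
    lookup-bad K e = Vec.lookup∘tabulate (not ∘ good K) e

    containsSome≡⊈bad : ∀ K E → containsSomeᵇ K (family m E) ≡ not (famSubᵇ (family m E) (family m (bad K)))
    containsSome≡⊈bad K E with containsSomeᵇ K (family m E) in hit
    ... | true with famSubᵇ (family m E) (family m (bad K)) in ⊆bad
    ...   | false = refl
    ...   | true with any⁻ (λ F → subsetᵇ F K) (family m E) hit
    ...     | F , F∈ , F⊆K
      with ∈-family⁻ {bad K} (memberᵇ⁻ {G = F} _ (all⁻ (λ G → memberᵇ G (family m (bad K))) _ ⊆bad F∈))
    ...       | ∣F∣≡m , b , b-bad , F⊆Pb
      with () ← trans (sym b-bad) (trans (lookup-bad K b) (cong not (m-subset⇒good K b F ∣F∣≡m F⊆K F⊆Pb)))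
    containsSome≡⊈bad K E | false = sym (cong not (all⁺ _ (family m E) moves))
      where
      moves : ∀ F → F ∈ family m E → memberᵇ F (family m (bad K)) ≡ true
      moves F F∈ with ∈-family⁻ {E} F∈
      ... | ∣F∣≡m , e , e∈E , F⊆Pe with good K e in e-good
      ...   | true with () ← trans (sym (good⇒containsSome K {E} e e∈E e-good)) hit
      ...   | false = memberᵇ⁺ (∈-family⁺ (bad K) F e ∣F∣≡m (trans (lookup-bad K e) (cong not e-good)) F⊆Pe)

    module _ (e₀ : Fin t) where

      top : List (Subset n)
      top = family m ⊤

      top∈ : top ∈ familyPoset ℓ
      top∈ = ∈-familyPoset⁺ ⊤ (member⇒nonempty ⊤ e₀ (Vec.lookup-replicate e₀ true))

      ⊆top : ∀ {𝒢} → 𝒢 ∈ familyPoset ℓ → famSubᵇ 𝒢 top ≡ true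
      ⊆top 𝒢∈ with ∈-familyPoset⁻ 𝒢∈
      ... | E , _ , refl = all⁺ _ (family m E) λ G G∈ →
        let (∣G∣≡m , e , _ , G⊆Pe) = ∈-family⁻ {E} G∈ in
        memberᵇ⁺ (∈-family⁺ ⊤ G e ∣G∣≡m (Vec.lookup-replicate e true) G⊆Pe)

      ∑-μC : ∑ (familyPoset ℓ) μC ≡ - + 1
      ∑-μC = trans (∑-cong-local (familyPoset ℓ) λ 𝒢 𝒢∈ →
                      trans (sym (ℤ.*-identityˡ (μC 𝒢))) (cong (λ b → 𝟙[ b ] * μC 𝒢) (sym (⊆top 𝒢∈))))
                   (∑-μC-downset top∈)

      committee⇒containsSome : ∀ K → all (good K) (allFin t) ≡ true →
        ∀ {𝒢} → 𝒢 ∈ familyPoset ℓ → containsSomeᵇ K 𝒢 ≡ true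
      committee⇒containsSome K committee 𝒢∈ with ∈-familyPoset⁻ 𝒢∈
      ... | E , E≠∅ , refl = let (e , e∈E) = nonempty⇒member E E≠∅ in
        good⇒containsSome K {E} e e∈E (all⁻ (good K) (allFin t) committee (∈.∈-allFin e))

      -- Only the families below 𝒢_{bad K} are missed by K.
      containsSome-split : ∀ K {𝒢} → 𝒢 ∈ familyPoset ℓ → μC 𝒢 * - 𝟙[ containsSomeᵇ K 𝒢 ] ≡
        𝟙[ famSubᵇ 𝒢 (family m (bad K)) ] * μC 𝒢 + - (𝟙[ famSubᵇ 𝒢 top ] * μC 𝒢)
      containsSome-split K {𝒢} 𝒢∈ rewrite ⊆top 𝒢∈ with ∈-familyPoset⁻ 𝒢∈
      ... | E , _ , refl rewrite containsSome≡⊈bad K E =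
        *-neg-𝟙-not (famSubᵇ (family m E) (family m (bad K))) (μC (family m E))

      ∑-μC-containsSome : ∀ K →
        ∑ (familyPoset ℓ) (λ 𝒢 → μC 𝒢 * - 𝟙[ containsSomeᵇ K 𝒢 ]) ≡ 𝟙[ all (good K) (allFin t) ]
      ∑-μC-containsSome K with all (good K) (allFin t) in committee
      ... | true = begin
        ∑ PC (λ 𝒢 → μC 𝒢 * - 𝟙[ containsSomeᵇ K 𝒢 ])
          ≡⟨ ∑-cong-local PC (λ 𝒢 𝒢∈ → cong (λ b → μC 𝒢 * - 𝟙[ b ]) (committee⇒containsSome K committee 𝒢∈)) ⟩
        ∑ PC (λ 𝒢 → μC 𝒢 * - + 1)
          ≡⟨ ∑-cong PC (λ 𝒢 → trans (cong -_ (sym (ℤ.*-identityʳ (μC 𝒢)))) (ℤ.neg-distribʳ-* (μC 𝒢) (+ 1))) ⟨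
        ∑ PC (λ 𝒢 → - μC 𝒢)
          ≡⟨ ∑-neg PC μC ⟩
        - ∑ PC μC
          ≡⟨ cong -_ ∑-μC ⟩
        + 1 ∎
        where
        open ≡-Reasoning
        PC = familyPoset ℓ
      ... | false with all-false⁻ (good K) (allFin t) committee
      ...   | b , _ , b-bad = begin
        ∑ PC (λ 𝒢 → μC 𝒢 * - 𝟙[ containsSomeᵇ K 𝒢 ])
          ≡⟨ ∑-cong-local PC (λ 𝒢 → containsSome-split K) ⟩
        ∑ PC (λ 𝒢 → 𝟙[ famSubᵇ 𝒢 𝒷 ] * μC 𝒢 + - (𝟙[ famSubᵇ 𝒢 top ] * μC 𝒢))
          ≡⟨ ∑-+ PC _ _ ⟩
        ∑ PC (λ 𝒢 → 𝟙[ famSubᵇ 𝒢 𝒷 ] * μC 𝒢) + ∑ PC (λ 𝒢 → - (𝟙[ famSubᵇ 𝒢 top ] * μC 𝒢))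
          ≡⟨ cong₂ _+_ (∑-μC-downset 𝒷∈) (trans (∑-neg PC _) (cong -_ (∑-μC-downset top∈))) ⟩
        - + 1 + + 1 ∎
        where
        open ≡-Reasoning
        PC = familyPoset ℓ
        𝒷 = family m (bad K)
        𝒷∈ : 𝒷 ∈ PC
        𝒷∈ = ∈-familyPoset⁺ (bad K) (member⇒nonempty (bad K) b (trans (lookup-bad K b) (cong not b-bad)))

      committeeCount≡mobiusFormula : + committeeCount ℓ ≡ mobiusFormula ℓ
      committeeCount≡mobiusFormula = sym (begin
        mobiusFormula ℓ
          ≡⟨ ∑-cong-local PC (λ 𝒢 𝒢∈ → cong (μC 𝒢 *_) (UnionClosure.unionSum-containsSome 𝒢 (m-sets 𝒢∈) ℓ)) ⟩
        ∑ PC (λ 𝒢 → μC 𝒢 * ∑ S (λ K → 𝟙[ ∣ K ∣ ≡ᵇ ℓ ] * - 𝟙[ containsSomeᵇ K 𝒢 ]))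
          ≡⟨ ∑-cong PC (λ 𝒢 → ∑-*ˡ S (μC 𝒢) _) ⟨
        ∑ PC (λ 𝒢 → ∑ S (λ K → μC 𝒢 * (𝟙[ ∣ K ∣ ≡ᵇ ℓ ] * - 𝟙[ containsSomeᵇ K 𝒢 ])))
          ≡⟨ ∑-comm PC S _ ⟩
        ∑ S (λ K → ∑ PC (λ 𝒢 → μC 𝒢 * (𝟙[ ∣ K ∣ ≡ᵇ ℓ ] * - 𝟙[ containsSomeᵇ K 𝒢 ])))
          ≡⟨ ∑-cong S (λ K → trans (∑-cong PC (λ 𝒢 → x∙yz≈y∙xz (μC 𝒢) 𝟙[ ∣ K ∣ ≡ᵇ ℓ ] (- 𝟙[ containsSomeᵇ K 𝒢 ])))
                                   (∑-*ˡ PC 𝟙[ ∣ K ∣ ≡ᵇ ℓ ] _)) ⟩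
        ∑ S (λ K → 𝟙[ ∣ K ∣ ≡ᵇ ℓ ] * ∑ PC (λ 𝒢 → μC 𝒢 * - 𝟙[ containsSomeᵇ K 𝒢 ]))
          ≡⟨ ∑-cong S (λ K → trans (cong (𝟙[ ∣ K ∣ ≡ᵇ ℓ ] *_) (∑-μC-containsSome K))
                                   (𝟙-∧ (∣ K ∣ ≡ᵇ ℓ) (all (good K) (allFin t)))) ⟩
        ∑ S (λ K → 𝟙[ isCommittee ℓ K ])
          ≡⟨ length-filterᵇ S (isCommittee ℓ) ⟨
        + committeeCount ℓ ∎)
        where
        open ≡-Reasoning
        PC = familyPoset ℓ
        S = allSubsets n
        m-sets : ∀ {𝒢} → 𝒢 ∈ PC → ∀ {F} → F ∈ 𝒢 → 0 < ∣ F ∣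
        m-sets 𝒢∈ F∈ with ∈-familyPoset⁻ 𝒢∈
        ... | E , _ , refl rewrite proj₁ (∈-family⁻ {E} F∈) = s≤s z≤n

-- Topes of a simple oriented matroid

∈-allSignVecs : ∀ t (X : SignVec t) → X ∈ allSignVecs t
∈-allSignVecs zero [] = here refl
∈-allSignVecs (suc t) (zer ∷ X) = ∈-prefixAll (zer ∷ pos ∷ neg ∷ []) (allSignVecs t) (here refl) (∈-allSignVecs t X)
∈-allSignVecs (suc t) (pos ∷ X) =
  ∈-prefixAll (zer ∷ pos ∷ neg ∷ []) (allSignVecs t) (there (here refl)) (∈-allSignVecs t X)
∈-allSignVecs (suc t) (neg ∷ X) =
  ∈-prefixAll (zer ∷ pos ∷ neg ∷ []) (allSignVecs t) (there (there (here refl))) (∈-allSignVecs t X)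

allSignVecs-unique : ∀ t → Unique (allSignVecs t)
allSignVecs-unique zero = [] ∷ []
allSignVecs-unique (suc t) =
  prefixAll-unique (zer ∷ pos ∷ neg ∷ []) (allSignVecs t)
    (((λ ()) ∷ (λ ()) ∷ []) ∷ ((λ ()) ∷ []) ∷ [] ∷ []) (allSignVecs-unique t)

==ˢ⇒≡ : ∀ {a b} → (a ==ˢ b) ≡ true → a ≡ b
==ˢ⇒≡ {zer} {zer} _ = refl
==ˢ⇒≡ {pos} {pos} _ = refl
==ˢ⇒≡ {neg} {neg} _ = refl

==ˢ-refl : ∀ a → (a ==ˢ a) ≡ true
==ˢ-refl zer = refl
==ˢ-refl pos = refl
==ˢ-refl neg = refl

negVec-involutive : ∀ {t} (X : SignVec t) → negVec (negVec X) ≡ X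
negVec-involutive [] = refl
negVec-involutive (zer ∷ X) = cong (zer ∷_) (negVec-involutive X)
negVec-involutive (pos ∷ X) = cong (pos ∷_) (negVec-involutive X)
negVec-involutive (neg ∷ X) = cong (neg ∷_) (negVec-involutive X)

module _ {t : ℕ} where

  conformal⁺ : ∀ (X Y : SignVec t) → (∀ f → ((lookup X f ==ˢ zer) ∨ (lookup X f ==ˢ lookup Y f)) ≡ true) →
    conformalᵇ X Y ≡ true
  conformal⁺ X Y h = all⁺ _ (allFin t) (λ f _ → h f)

  conformal⁻ : ∀ (X Y : SignVec t) → conformalᵇ X Y ≡ true →
    ∀ f → ((lookup X f ==ˢ zer) ∨ (lookup X f ==ˢ lookup Y f)) ≡ true
  conformal⁻ X Y h f = all⁻ _ (allFin t) h (∈.∈-allFin f)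

  lookup-compose : ∀ (X Y : SignVec t) f →
    lookup (compose X Y) f ≡ (if lookup X f ==ˢ zer then lookup Y f else lookup X f)
  lookup-compose X Y f = Vec.lookup-zipWith _ f X Y

  conformal-compose : ∀ (X Y : SignVec t) → conformalᵇ X (compose X Y) ≡ true
  conformal-compose X Y = conformal⁺ X (compose X Y) below
    where
    below : ∀ f → ((lookup X f ==ˢ zer) ∨ (lookup X f ==ˢ lookup (compose X Y) f)) ≡ true
    below f rewrite lookup-compose X Y f with lookup X f
    ... | zer = refl
    ... | pos = refl
    ... | neg = refl

  conformal-negVec : ∀ (X Y : SignVec t) → conformalᵇ (negVec X) Y ≡ true → conformalᵇ X (negVec Y) ≡ true
  conformal-negVec X Y h = conformal⁺ X (negVec Y) λ f →
    subst (λ s → ((lookup X f ==ˢ zer) ∨ (lookup X f ==ˢ s)) ≡ true) (sym (Vec.lookup-map f opp Y))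
      (flip (lookup X f) (lookup Y f) (subst (λ s → ((s ==ˢ zer) ∨ (s ==ˢ lookup Y f)) ≡ true)
        (Vec.lookup-map f opp X) (conformal⁻ (negVec X) Y h f)))
    where
    flip : ∀ a b → ((opp a ==ˢ zer) ∨ (opp a ==ˢ b)) ≡ true → ((a ==ˢ zer) ∨ (a ==ˢ opp b)) ≡ true
    flip zer b _ = refl
    flip pos neg _ = refl
    flip neg pos _ = refl

unitVec : ∀ {t} → Fin t → SignVec t
unitVec zero = pos ∷ zeroVec
unitVec (suc e) = zer ∷ unitVec e

unitVec-self : ∀ {t} (e : Fin t) → lookup (unitVec e) e ≢ zer
unitVec-self zero ()
unitVec-self (suc e) = unitVec-self e

unitVec-support : ∀ {t} (e g : Fin t) → lookup (unitVec e) g ≢ zer → g ≡ e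
unitVec-support zero zero _ = refl
unitVec-support zero (suc g) g∈ = ⊥-elim (g∈ (Vec.lookup-replicate g zer))
unitVec-support (suc e) zero g∈ = ⊥-elim (g∈ refl)
unitVec-support (suc e) (suc g) g∈ = cong suc (unitVec-support e g g∈)

·ˢ-zeroʳ : ∀ s → (s ·ˢ zer) ≡ zer
·ˢ-zeroʳ zer = refl
·ˢ-zeroʳ pos = refl
·ˢ-zeroʳ neg = refl

vanishing⇒loop : ∀ {t} (L : SignVec t → Bool) e → (∀ X → X ∈L L → lookup X e ≡ zer) → IsLoop L e
vanishing⇒loop L e vanish =
  unitVec e , (orthogonal , (e , unitVec-self e) , minimal) , λ g → unitVec-support e g , λ { refl → unitVec-self e }
  where
  orthogonal : IsVector L (unitVec e)
  orthogonal X LX = inj₁ product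
    where
    product : ∀ f → (lookup X f ·ˢ lookup (unitVec e) f) ≡ zer
    product f with lookup (unitVec e) f | unitVec-support e f
    ... | zer | _ = ·ˢ-zeroʳ (lookup X f)
    ... | pos | f≡e rewrite f≡e (λ ()) | vanish X LX = refl
    ... | neg | f≡e rewrite f≡e (λ ()) | vanish X LX = refl
  minimal : ∀ W → IsVector L W → NonZero W → SuppSub W (unitVec e) → SuppSub (unitVec e) W
  minimal W _ (f , f∈W) W⊆U g g∈U with unitVec-support e g g∈U | unitVec-support e f (W⊆U f f∈W)
  ... | refl | refl = f∈W

module Topes {t : ℕ} (L : SignVec t → Bool) where

  tope⇒covector : ∀ {T} → isTopeᵇ L T ≡ true → T ∈L L
  tope⇒covector {T} h with L T
  ... | true = refl

  tope-maximal : ∀ {T Y} → isTopeᵇ L T ≡ true → Y ∈L L → conformalᵇ T Y ≡ true → Y ≡ T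
  tope-maximal {T} {Y} h LY T≤Y with L T | h
  ... | true | h′ with all⁻ _ (allSignVecs t) h′ (∈-allSignVecs t Y)
  ...   | Y≡T rewrite LY | T≤Y = vecEqᵇ⇒≡ ==ˢ⇒≡ Y≡T

  tope⁺ : ∀ {T} → T ∈L L → (∀ Y → Y ∈L L → conformalᵇ T Y ≡ true → Y ≡ T) → isTopeᵇ L T ≡ true
  tope⁺ {T} LT maximal rewrite LT = all⁺ _ (allSignVecs t) below
    where
    below : ∀ Y → Y ∈ allSignVecs t → (not (L Y ∧ conformalᵇ T Y) ∨ vecEqᵇ _==ˢ_ Y T) ≡ true
    below Y _ with L Y in LY | conformalᵇ T Y in T≤Y
    ... | false | _ = refl
    ... | true | false = refl
    ... | true | true rewrite maximal Y LY T≤Y = vecEqᵇ-refl ==ˢ-refl T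

  module _ (om : IsOrientedMatroid L) where

    open IsOrientedMatroid om

    negVec-tope : ∀ {T} → isTopeᵇ L T ≡ true → isTopeᵇ L (negVec T) ≡ true
    negVec-tope {T} T-tope = tope⁺ (V1 T (tope⇒covector T-tope)) λ Y LY −T≤Y →
      trans (sym (negVec-involutive Y))
        (cong negVec (tope-maximal T-tope (V1 Y LY) (conformal-negVec T Y −T≤Y)))

    -- A covector X with X e ≠ 0 would give a covector T ∘ X ≥ T with (T ∘ X) e ≠ 0 = T e;
    -- if there is none, e is a loop.
    tope-nonzero : IsSimple L → ∀ {T} → isTopeᵇ L T ≡ true → ∀ e → lookup T e ≢ zer
    tope-nonzero simple {T} T-tope e Te≡0
      with any (λ X → L X ∧ not (lookup X e ==ˢ zer)) (allSignVecs t) in some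
    ... | false = proj₁ simple e (vanishing⇒loop L e vanish)
      where
      vanish : ∀ X → X ∈L L → lookup X e ≡ zer
      vanish X LX with lookup X e ==ˢ zer in Xe≡0
      ... | true = ==ˢ⇒≡ Xe≡0
      ... | false with () ← trans (sym (any⁺ (λ X → L X ∧ not (lookup X e ==ˢ zer)) (∈-allSignVecs t X)
                                     (cong₂ _∧_ LX (cong not Xe≡0)))) some
    ... | true with any⁻ (λ X → L X ∧ not (lookup X e ==ˢ zer)) (allSignVecs t) some
    ...   | X , _ , witness with L X in LX | lookup X e ==ˢ zer in Xe≡0
    ...     | true | false = true≢false (trans (sym (cong (_==ˢ zer) (trans Xe≡Te Te≡0))) Xe≡0)
      where
      T∘X≡T : compose T X ≡ T
      T∘X≡T = tope-maximal T-tope (V2 T X (tope⇒covector T-tope) LX) (conformal-compose T X)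
      Xe≡Te : lookup X e ≡ lookup T e
      Xe≡Te = begin
        lookup X e
          ≡⟨ cong (λ s → if s ==ˢ zer then lookup X e else s) Te≡0 ⟨
        (if lookup T e ==ˢ zer then lookup X e else lookup T e)
          ≡⟨ lookup-compose T X e ⟨
        lookup (compose T X) e
          ≡⟨ cong (λ Y → lookup Y e) T∘X≡T ⟩
        lookup T e ∎
        where open ≡-Reasoning
      true≢false : true ≡ false → Empty
      true≢false ()

-- The symmetry k ↔ |𝒯| − k

∑-allFin-suc : ∀ n (g : Fin (suc n) → ℤ) → ∑ (allFin (suc n)) g ≡ g zero + ∑ (allFin n) (g ∘ suc)
∑-allFin-suc n g = cong (_+_ (g zero)) (begin
  ∑ (Data.List.tabulate suc) g ≡⟨ cong (λ is → ∑ is g) (List.map-tabulate (λ i → i) suc) ⟨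
  ∑ (map suc (allFin n)) g     ≡⟨ ∑-map suc (allFin n) g ⟩
  ∑ (allFin n) (g ∘ suc)       ∎)
  where open ≡-Reasoning

∣∣≡∑ : ∀ {n} (A : Subset n) → + ∣ A ∣ ≡ ∑ (allFin n) (λ i → 𝟙[ lookup A i ])
∣∣≡∑ [] = refl
∣∣≡∑ {suc n} (a ∷ A) = trans (step a) (sym (∑-allFin-suc n (λ i → 𝟙[ lookup (a ∷ A) i ])))
  where
  step : ∀ a → + ∣ a ∷ A ∣ ≡ 𝟙[ a ] + ∑ (allFin n) (λ i → 𝟙[ lookup A i ])
  step true = cong (_+_ (+ 1)) (∣∣≡∑ A)
  step false = trans (∣∣≡∑ A) (sym (ℤ.+-identityˡ _))

∣p∪q∣+∣p∩q∣≡∣p∣+∣q∣ : ∀ {n} (p q : Subset n) → ∣ p ∪ q ∣ ℕ.+ ∣ p ∩ q ∣ ≡ ∣ p ∣ ℕ.+ ∣ q ∣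
∣p∪q∣+∣p∩q∣≡∣p∣+∣q∣ [] [] = refl
∣p∪q∣+∣p∩q∣≡∣p∣+∣q∣ (true ∷ p) (true ∷ q) =
  cong suc (trans (ℕ.+-suc _ _) (trans (cong suc (∣p∪q∣+∣p∩q∣≡∣p∣+∣q∣ p q)) (sym (ℕ.+-suc _ _))))
∣p∪q∣+∣p∩q∣≡∣p∣+∣q∣ (true ∷ p) (false ∷ q) = cong suc (∣p∪q∣+∣p∩q∣≡∣p∣+∣q∣ p q)
∣p∪q∣+∣p∩q∣≡∣p∣+∣q∣ (false ∷ p) (true ∷ q) = trans (cong suc (∣p∪q∣+∣p∩q∣≡∣p∣+∣q∣ p q)) (sym (ℕ.+-suc _ _))
∣p∪q∣+∣p∩q∣≡∣p∣+∣q∣ (false ∷ p) (false ∷ q) = ∣p∪q∣+∣p∩q∣≡∣p∣+∣q∣ p q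

<ᵇ-cancel : ∀ a b d k → a ℕ.+ k ≡ d ℕ.+ b → (d <ᵇ a) ≡ (k <ᵇ b)
<ᵇ-cancel a b d k a+k≡d+b = ≡true-⇔⇒≡
  (λ d<a → <⇒<ᵇ (ℕ.+-cancelˡ-< d k b (subst (d ℕ.+ k <_) a+k≡d+b (ℕ.+-monoˡ-< k (<ᵇ⇒< d<a)))))
  (λ k<b → <⇒<ᵇ (ℕ.+-cancelʳ-< k d a (subst (d ℕ.+ k <_) (sym a+k≡d+b) (ℕ.+-monoʳ-< d (<ᵇ⇒< k<b)))))
  where
  <ᵇ⇒< : ∀ {i j} → (i <ᵇ j) ≡ true → i < j
  <ᵇ⇒< {i} {j} h = ℕ.<ᵇ⇒< i j (Equivalence.from T-≡ h)
  <⇒<ᵇ : ∀ {i j} → i < j → (i <ᵇ j) ≡ true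
  <⇒<ᵇ i<j = Equivalence.to T-≡ (ℕ.<⇒<ᵇ i<j)

≡ᵇ-complement : ∀ {n k} a b → k ≤ n → a ℕ.+ b ≡ n → (a ≡ᵇ n ∸ k) ≡ (b ≡ᵇ k)
≡ᵇ-complement {n} {k} a b k≤n a+b≡n = ≡true-⇔⇒≡
  (λ a≡n∸k → ≡⇒≡ᵇ (ℕ.+-cancelˡ-≡ (n ∸ k) b k (trans (cong (ℕ._+ b) (sym (≡ᵇ⇒≡ {a} {n ∸ k} a≡n∸k)))
                                                  (trans a+b≡n (sym (ℕ.m∸n+n≡m k≤n))))))
  (λ b≡k → ≡⇒≡ᵇ (trans (sym (ℕ.m+n∸n≡m a b)) (trans (cong (_∸ b) a+b≡n) (cong (n ∸_) (≡ᵇ⇒≡ {b} {k} b≡k)))))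
  where
  ≡ᵇ⇒≡ : ∀ {i j} → (i ≡ᵇ j) ≡ true → i ≡ j
  ≡ᵇ⇒≡ {i} {j} h = ℕ.≡ᵇ⇒≡ i j (Equivalence.from T-≡ h)
  ≡⇒≡ᵇ : ∀ {i j} → i ≡ j → (i ≡ᵇ j) ≡ true
  ≡⇒≡ᵇ {i} {j} i≡j = Equivalence.to T-≡ (ℕ.≡⇒≡ᵇ i j i≡j)

-- Used with d = n ∸ k, x = ∣ ∁ (−K) ∩ 𝒯⁺_e ∣, u = ∣ K ∪ 𝒯⁺_e ∣, c = ∣ K ∩ 𝒯⁺_e ∣ and p = ∣ 𝒯⁺_e ∣.
majority-complement : ∀ n k d x u c p → d ℕ.+ k ≡ n → x ℕ.+ u ≡ n → u ℕ.+ c ≡ k ℕ.+ p → p ℕ.+ p ≡ n →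
  (d <ᵇ 2 ℕ.* x) ≡ (k <ᵇ 2 ℕ.* c)
majority-complement n k d x u c p d+k≡n x+u≡n u+c≡k+p p+p≡n =
  <ᵇ-cancel (2 ℕ.* x) (2 ℕ.* c) d k (ℕ.+-cancelʳ-≡ (2 ℕ.* u) (2 ℕ.* x ℕ.+ k) (d ℕ.+ 2 ℕ.* c) (begin
    2 ℕ.* x ℕ.+ k ℕ.+ 2 ℕ.* u
      ≡⟨ solve 3 (λ x k u → con 2 :* x :+ k :+ con 2 :* u := con 2 :* (x :+ u) :+ k) refl x k u ⟩
    2 ℕ.* (x ℕ.+ u) ℕ.+ k
      ≡⟨ cong (λ y → 2 ℕ.* y ℕ.+ k) x+u≡n ⟩
    2 ℕ.* n ℕ.+ k
      ≡⟨ solve 2 (λ n k → con 2 :* n :+ k := n :+ k :+ n) refl n k ⟩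
    n ℕ.+ k ℕ.+ n
      ≡⟨ cong₂ (λ y z → y ℕ.+ k ℕ.+ z) d+k≡n p+p≡n ⟨
    d ℕ.+ k ℕ.+ k ℕ.+ (p ℕ.+ p)
      ≡⟨ solve 3 (λ d k p → d :+ k :+ k :+ (p :+ p) := d :+ con 2 :* (k :+ p)) refl d k p ⟩
    d ℕ.+ 2 ℕ.* (k ℕ.+ p)
      ≡⟨ cong (λ y → d ℕ.+ 2 ℕ.* y) u+c≡k+p ⟨
    d ℕ.+ 2 ℕ.* (u ℕ.+ c)
      ≡⟨ solve 3 (λ d u c → d :+ con 2 :* (u :+ c) := d :+ con 2 :* c :+ con 2 :* u) refl d u c ⟩
    d ℕ.+ 2 ℕ.* c ℕ.+ 2 ℕ.* u ∎))
  where
  open ≡-Reasoning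
  open +-*-Solver

lookup-ext : ∀ {A : Set} {n} {xs ys : Vec A n} → (∀ i → lookup xs i ≡ lookup ys i) → xs ≡ ys
lookup-ext {xs = xs} {ys} h = trans (sym (Vec.tabulate∘lookup xs)) (trans (Vec.tabulate-cong h) (Vec.tabulate∘lookup ys))

module _ {A : Set} where

  lookup-injective : ∀ {xs : List A} → Unique xs → ∀ i j → Data.List.lookup xs i ≡ Data.List.lookup xs j → i ≡ j
  lookup-injective (_ ∷ _) zero zero _ = refl
  lookup-injective (x∉xs ∷ _) zero (suc j) x≡xsⱼ = ⊥-elim (All.lookup x∉xs (∈.∈-lookup j) x≡xsⱼ)
  lookup-injective (x∉xs ∷ _) (suc i) zero xsᵢ≡x = ⊥-elim (All.lookup x∉xs (∈.∈-lookup i) (sym xsᵢ≡x))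
  lookup-injective (_ ∷ u) (suc i) (suc j) xsᵢ≡xsⱼ = cong suc (lookup-injective u i j xsᵢ≡xsⱼ)

_≟ᵇ_ : ∀ {n} → Fin n → Fin n → Bool
i ≟ᵇ j = does (i ≟ j)

≟ᵇ⇒≡ : ∀ {n} {i j : Fin n} → (i ≟ᵇ j) ≡ true → i ≡ j
≟ᵇ⇒≡ {i = i} {j} h with i ≟ j
... | yes i≡j = i≡j

≟ᵇ-refl : ∀ {n} (i : Fin n) → (i ≟ᵇ i) ≡ true
≟ᵇ-refl i = dec-true (i ≟ i) refl

module Symmetry {t : ℕ} (L : SignVec t → Bool) (om : IsOrientedMatroid L) (simple : IsSimple L) where

  open Topes L

  N : ℕ
  N = nTopes L

  tope : Fin N → SignVec t
  tope i = Data.List.lookup (topes L) i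

  tope-isTope : ∀ i → isTopeᵇ L (tope i) ≡ true
  tope-isTope i = proj₂ (∈-filterᵇ⁻ (isTopeᵇ L) {allSignVecs t} (∈.∈-lookup i))

  tope-injective : ∀ i j → tope i ≡ tope j → i ≡ j
  tope-injective = lookup-injective (Unique.filter⁺ (T? ∘ isTopeᵇ L) (allSignVecs-unique t))

  negVec-tope∈ : ∀ i → negVec (tope i) ∈ topes L
  negVec-tope∈ i = ∈-filterᵇ⁺ (isTopeᵇ L) (∈-allSignVecs t _) (negVec-tope om (tope-isTope i))

  opposite : Fin N → Fin N
  opposite i = Any.index (negVec-tope∈ i)

  tope-opposite : ∀ i → tope (opposite i) ≡ negVec (tope i)
  tope-opposite i = sym (AnyP.lookup-index (negVec-tope∈ i))

  opposite-involutive : ∀ i → opposite (opposite i) ≡ i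
  opposite-involutive i = tope-injective _ _ (begin
    tope (opposite (opposite i)) ≡⟨ tope-opposite (opposite i) ⟩
    negVec (tope (opposite i))   ≡⟨ cong negVec (tope-opposite i) ⟩
    negVec (negVec (tope i))     ≡⟨ negVec-involutive (tope i) ⟩
    tope i                       ∎)
    where open ≡-Reasoning

  Tplus-opposite : ∀ e i → lookup (Tplus L e) (opposite i) ≡ not (lookup (Tplus L e) i)
  Tplus-opposite e i = begin
    lookup (Tplus L e) (opposite i)        ≡⟨ Vec.lookup∘tabulate _ (opposite i) ⟩
    (lookup (tope (opposite i)) e ==ˢ pos) ≡⟨ cong (λ T → lookup T e ==ˢ pos) (tope-opposite i) ⟩
    (lookup (negVec (tope i)) e ==ˢ pos)   ≡⟨ cong (_==ˢ pos) (Vec.lookup-map e opp (tope i)) ⟩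
    (opp (lookup (tope i) e) ==ˢ pos)      ≡⟨ opp-pos (tope-nonzero om simple (tope-isTope i) e) ⟩
    not (lookup (tope i) e ==ˢ pos)        ≡⟨ cong not (Vec.lookup∘tabulate _ i) ⟨
    not (lookup (Tplus L e) i)             ∎
    where
    open ≡-Reasoning
    opp-pos : ∀ {s} → s ≢ zer → (opp s ==ˢ pos) ≡ not (s ==ˢ pos)
    opp-pos {zer} s≢0 = ⊥-elim (s≢0 refl)
    opp-pos {pos} _ = refl
    opp-pos {neg} _ = refl

  oppositeSet : Subset N → Subset N
  oppositeSet A = tabulate (lookup A ∘ opposite)

  ∣oppositeSet∣ : ∀ A → ∣ oppositeSet A ∣ ≡ ∣ A ∣
  ∣oppositeSet∣ A = ℤ.+-injective (begin
    + ∣ oppositeSet A ∣                                ≡⟨ ∣∣≡∑ (oppositeSet A) ⟩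
    ∑ (allFin N) (λ i → 𝟙[ lookup (oppositeSet A) i ]) ≡⟨ ∑-cong (allFin N) (λ i → cong 𝟙[_] (Vec.lookup∘tabulate _ i)) ⟩
    ∑ (allFin N) (λ i → 𝟙[ lookup A (opposite i) ])    ≡⟨ ∑-involution ≟ᵇ⇒≡ ≟ᵇ-refl (Unique.allFin⁺ N) ∈.∈-allFin
                                                         opposite-involutive (λ i → 𝟙[ lookup A i ]) ⟩
    ∑ (allFin N) (λ i → 𝟙[ lookup A i ]) ≡⟨ ∣∣≡∑ A ⟨
    + ∣ A ∣                              ∎)
    where open ≡-Reasoning

  ∣∁oppositeSet∣+∣∣≡N : ∀ A → ∣ ∁ (oppositeSet A) ∣ ℕ.+ ∣ A ∣ ≡ N
  ∣∁oppositeSet∣+∣∣≡N A = begin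
    ∣ ∁ (oppositeSet A) ∣ ℕ.+ ∣ A ∣   ≡⟨ cong (ℕ._+ ∣ A ∣) (∣∁p∣≡n∸∣p∣ (oppositeSet A)) ⟩
    (N ∸ ∣ oppositeSet A ∣) ℕ.+ ∣ A ∣ ≡⟨ cong (λ j → (N ∸ j) ℕ.+ ∣ A ∣) (∣oppositeSet∣ A) ⟩
    (N ∸ ∣ A ∣) ℕ.+ ∣ A ∣             ≡⟨ ℕ.m∸n+n≡m (∣p∣≤n A) ⟩
    N                                 ∎
    where open ≡-Reasoning

  ∁oppositeSet-Tplus : ∀ e → ∁ (oppositeSet (Tplus L e)) ≡ Tplus L e
  ∁oppositeSet-Tplus e = lookup-ext λ i → begin
    lookup (∁ (oppositeSet (Tplus L e))) i   ≡⟨ Vec.lookup-map i not (oppositeSet (Tplus L e)) ⟩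
    not (lookup (oppositeSet (Tplus L e)) i) ≡⟨ cong not (Vec.lookup∘tabulate _ i) ⟩
    not (lookup (Tplus L e) (opposite i))    ≡⟨ cong not (Tplus-opposite e i) ⟩
    not (not (lookup (Tplus L e) i))         ≡⟨ not-involutive _ ⟩
    lookup (Tplus L e) i                     ∎
    where open ≡-Reasoning

  ∣Tplus∣+∣Tplus∣≡N : ∀ e → ∣ Tplus L e ∣ ℕ.+ ∣ Tplus L e ∣ ≡ N
  ∣Tplus∣+∣Tplus∣≡N e =
    subst (λ A → ∣ A ∣ ℕ.+ ∣ Tplus L e ∣ ≡ N) (∁oppositeSet-Tplus e) (∣∁oppositeSet∣+∣∣≡N (Tplus L e))

  complementOpposite : Subset N → Subset N
  complementOpposite K = ∁ (oppositeSet K)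

  complementOpposite-involutive : ∀ K → complementOpposite (complementOpposite K) ≡ K
  complementOpposite-involutive K = lookup-ext λ i → begin
    lookup (∁ (oppositeSet (∁ (oppositeSet K)))) i   ≡⟨ Vec.lookup-map i not (oppositeSet (∁ (oppositeSet K))) ⟩
    not (lookup (oppositeSet (∁ (oppositeSet K))) i) ≡⟨ cong not (Vec.lookup∘tabulate _ i) ⟩
    not (lookup (∁ (oppositeSet K)) (opposite i))    ≡⟨ cong not (Vec.lookup-map (opposite i) not (oppositeSet K)) ⟩
    not (not (lookup (oppositeSet K) (opposite i)))  ≡⟨ not-involutive _ ⟩
    lookup (oppositeSet K) (opposite i)              ≡⟨ Vec.lookup∘tabulate _ (opposite i) ⟩
    lookup K (opposite (opposite i))                 ≡⟨ cong (lookup K) (opposite-involutive i) ⟩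
    lookup K i                                       ∎
    where open ≡-Reasoning

  complementOpposite-∩ : ∀ K e → complementOpposite K ∩ Tplus L e ≡ ∁ (oppositeSet (K ∪ Tplus L e))
  complementOpposite-∩ K e = lookup-ext λ i → begin
    lookup (∁ (oppositeSet K) ∩ Tplus L e) i
      ≡⟨ Vec.lookup-zipWith _∧_ i (∁ (oppositeSet K)) (Tplus L e) ⟩
    lookup (∁ (oppositeSet K)) i ∧ lookup (Tplus L e) i
      ≡⟨ cong₂ _∧_ (trans (Vec.lookup-map i not (oppositeSet K)) (cong not (Vec.lookup∘tabulate _ i)))
                   (trans (sym (not-involutive (lookup (Tplus L e) i))) (cong not (sym (Tplus-opposite e i)))) ⟩
    not (lookup K (opposite i)) ∧ not (lookup (Tplus L e) (opposite i))
      ≡⟨ deMorgan (lookup K (opposite i)) (lookup (Tplus L e) (opposite i)) ⟩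
    not (lookup K (opposite i) ∨ lookup (Tplus L e) (opposite i))
      ≡⟨ cong not (Vec.lookup-zipWith _∨_ (opposite i) K (Tplus L e)) ⟨
    not (lookup (K ∪ Tplus L e) (opposite i))
      ≡⟨ cong not (Vec.lookup∘tabulate _ i) ⟨
    not (lookup (oppositeSet (K ∪ Tplus L e)) i)
      ≡⟨ Vec.lookup-map i not (oppositeSet (K ∪ Tplus L e)) ⟨
    lookup (∁ (oppositeSet (K ∪ Tplus L e))) i ∎
    where
    open ≡-Reasoning
    deMorgan : ∀ a b → not a ∧ not b ≡ not (a ∨ b)
    deMorgan true b = refl
    deMorgan false b = refl

  isCommittee-complementOpposite : ∀ k → k ≤ N → ∀ K →
    isCommitteeᵇ L (N ∸ k) (complementOpposite K) ≡ isCommitteeᵇ L k K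
  isCommittee-complementOpposite k k≤N K =
    ∧-cong-guarded (≡ᵇ-complement (∣ complementOpposite K ∣) (∣ K ∣) k≤N (∣∁oppositeSet∣+∣∣≡N K))
      (λ ∣K∣≡ᵇk → cong and (List.map-cong (majority (ℕ.≡ᵇ⇒≡ _ _ (Equivalence.from T-≡ ∣K∣≡ᵇk)))
                                          (allFin t)))
    where
    majority : ∣ K ∣ ≡ k → ∀ e →
      ((N ∸ k) <ᵇ 2 ℕ.* ∣ complementOpposite K ∩ Tplus L e ∣) ≡ (k <ᵇ 2 ℕ.* ∣ K ∩ Tplus L e ∣)
    majority ∣K∣≡k e = majority-complement N k (N ∸ k) (∣ complementOpposite K ∩ Tplus L e ∣) (∣ K ∪ Tplus L e ∣)
      (∣ K ∩ Tplus L e ∣) (∣ Tplus L e ∣) (ℕ.m∸n+n≡m k≤N)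
      (subst (λ A → ∣ A ∣ ℕ.+ ∣ K ∪ Tplus L e ∣ ≡ N) (sym (complementOpposite-∩ K e))
             (∣∁oppositeSet∣+∣∣≡N (K ∪ Tplus L e)))
      (trans (∣p∪q∣+∣p∩q∣≡∣p∣+∣q∣ K (Tplus L e)) (cong (ℕ._+ ∣ Tplus L e ∣) ∣K∣≡k))
      (∣Tplus∣+∣Tplus∣≡N e)

  numCommittees-complement : ∀ k → k ≤ N → numCommittees L k ≡ numCommittees L (N ∸ k)
  numCommittees-complement k k≤N = ℤ.+-injective (begin
    + numCommittees L k
      ≡⟨ length-filterᵇ S (isCommitteeᵇ L k) ⟩
    ∑ S (λ K → 𝟙[ isCommitteeᵇ L k K ])
      ≡⟨ ∑-cong S (λ K → cong 𝟙[_] (isCommittee-complementOpposite k k≤N K)) ⟨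
    ∑ S (λ K → 𝟙[ isCommitteeᵇ L (N ∸ k) (complementOpposite K) ])
      ≡⟨ ∑-involution (subsetEq⇒≡ {N}) subsetEq-refl (allSubsets-unique N) (∈-allSubsets N)
           {complementOpposite} complementOpposite-involutive (λ K → 𝟙[ isCommitteeᵇ L (N ∸ k) K ]) ⟩
    ∑ S (λ K → 𝟙[ isCommitteeᵇ L (N ∸ k) K ])
      ≡⟨ length-filterᵇ S (isCommitteeᵇ L (N ∸ k)) ⟨
    + numCommittees L (N ∸ k) ∎)
    where
    open ≡-Reasoning
    S = allSubsets N

proposition3p2 : (t : ℕ) (L : SignVec t → Bool) →
    IsOrientedMatroid L → IsSimple L → ¬ IsAcyclic L →
    (k ℓ : ℕ) → 3 ≤ k → k ≤ nTopes L ∸ 3 →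
    (ℓ ≡ k ⊎ ℓ ≡ nTopes L ∸ k) →
    (numCommittees L k ≡ numCommittees L (nTopes L ∸ k))
    × (+ numCommittees L k ≡ committeeFormula L ℓ)
-- For t = 0 there is at most one tope, contradicting 3 ≤ k ≤ |𝒯| − 3.
proposition3p2 zero L _ _ _ k ℓ 3≤k k≤N∸3 _ =
  ⊥-elim (ℕ.<⇒≱ (ℕ.≤-trans 3≤k k≤N∸3)
                 (ℕ.≤-trans (ℕ.∸-monoˡ-≤ 3 (List.length-filter (T? ∘ isTopeᵇ L) (allSignVecs 0))) z≤n))
proposition3p2 (suc t) L om simple _ k ℓ _ k≤N∸3 ℓ-choice = symmetric , formula ℓ-choice
  where
  open Symmetry L om simple using (N; numCommittees-complement)
  symmetric : numCommittees L k ≡ numCommittees L (N ∸ k)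
  symmetric = numCommittees-complement k (ℕ.≤-trans k≤N∸3 (ℕ.m∸n≤m N 3))
  formula : ℓ ≡ k ⊎ ℓ ≡ N ∸ k → + numCommittees L k ≡ committeeFormula L ℓ
  formula (inj₁ refl) = Committees.committeeCount≡mobiusFormula (Tplus L) k zero
  formula (inj₂ refl) = trans (cong +_ symmetric) (Committees.committeeCount≡mobiusFormula (Tplus L) (N ∸ k) zero)
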